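{- Let $G=(V,E^+,E^-)$ be a complete signed graph and $F$ a bad triangle cover of $G$. Run the following randomized pivot procedure: initially all vertices are unclustered; while some vertex is unclustered, pick a pivot $u$ uniformly at random among the unclustered vertices, set $P_u=\{u\}$, and for every other unclustered $v$ independently add $v$ to $P_u$ with probability $1$ if $uv\in E^+\setminus F$, $1/4$ if $uv\in E^+\cap F$, $3/4$ if $uv\in E^-\cap F$, and $0$ if $uv\in E^-\setminus F$; then mark all vertices of $P_u$ as clustered and add $P_u$ as a cluster. The resulting clustering has expected number of disagreements at most $\frac{3}{2}|F|$.
   Context: A complete signed graph has every pair of distinct vertices in exactly one of $E^+$ (positive) or $E^-$ (negative). A bad triangle is a triple of vertices with exactly one negative pair; a bad triangle cover is a set $F$ of vertex pairs containing at least one pair of every bad triangle. The number of disagreements (mistakes) of a partition of $V$ is the number of positive edges between different parts plus the number of negative edges within parts. -}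

module Defs where

open import Data.Bool using (Bool; true; false; _∧_; _∨_; not; if_then_else_)
open import Data.Nat using (ℕ; zero; suc; _<ᵇ_)
open import Data.Fin using (Fin; toℕ; _≟_)
open import Data.List using (List; []; _∷_; length; allFin; filter; map; concatMap; foldr; _++_)
open import Data.Bool.ListAction using (any)
open import Data.Product using (_×_; _,_)
open import Data.Integer using (+_)
open import Data.Rational using (ℚ; _/_; _+_; _*_; _-_; 0ℚ; 1ℚ)
open import Relation.Binary.PropositionalEquality using (_≡_)
open import Relation.Nullary.Decidable using (⌊_⌋)
open import Data.Sum using (_⊎_)

-- A complete signed graph on vertex set Fin n: pos i j = true iff ij ∈ E⁺,
-- otherwise ij ∈ E⁻.  It is undirected (symmetric); the diagonal is irrelevant.
record SignedGraph (n : ℕ) : Set where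
  field
    pos : Fin n → Fin n → Bool
    pos-sym : ∀ i j → pos i j ≡ pos j i

open SignedGraph public

record PairSet (n : ℕ) : Set where
  field
    mem : Fin n → Fin n → Bool
    mem-sym : ∀ i j → mem i j ≡ mem j i

open PairSet public

nFalse : List Bool → ℕ
nFalse [] = 0
nFalse (false ∷ bs) = suc (nFalse bs)
nFalse (true ∷ bs) = nFalse bs

BadTriangle : ∀ {n} → SignedGraph n → Fin n → Fin n → Fin n → Set
BadTriangle G i j k =
  (i ≡ j → Data.Empty.⊥) × (j ≡ k → Data.Empty.⊥) × (i ≡ k → Data.Empty.⊥)
  × nFalse (pos G i j ∷ pos G j k ∷ pos G i k ∷ []) ≡ 1
  where import Data.Empty

IsBadTriangleCover : ∀ {n} → SignedGraph n → PairSet n → Set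
IsBadTriangleCover G F = ∀ i j k → BadTriangle G i j k →
  (mem F i j ≡ true) ⊎ (mem F j k ≡ true) ⊎ (mem F i k ≡ true)

countPairs : ∀ {n} → (Fin n → Fin n → Bool) → ℕ
countPairs {n} P = nTrue (concatMap (λ i → map (λ j → (toℕ i <ᵇ toℕ j) ∧ P i j) (allFin n)) (allFin n))
  where
  nTrue : List Bool → ℕ
  nTrue [] = 0
  nTrue (true ∷ bs) = suc (nTrue bs)
  nTrue (false ∷ bs) = nTrue bs

card : ∀ {n} → PairSet n → ℕ
card F = countPairs (mem F)

Clustering : ℕ → Set
Clustering n = List (List (Fin n))

elem : ∀ {n} → Fin n → List (Fin n) → Bool
elem x [] = false
elem x (y ∷ ys) = ⌊ x ≟ y ⌋ ∨ elem x ys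

sameCluster : ∀ {n} → Clustering n → Fin n → Fin n → Bool
sameCluster C i j = any (λ P → elem i P ∧ elem j P) C

mistakes : ∀ {n} → SignedGraph n → Clustering n → ℕ
mistakes G C = countPairs (λ i j →
  (pos G i j ∧ not (sameCluster C i j)) ∨ (not (pos G i j) ∧ sameCluster C i j))

Dist : Set → Set
Dist A = List (ℚ × A)

joinProb : ∀ {n} → SignedGraph n → PairSet n → Fin n → Fin n → ℚ
joinProb G F u v with pos G u v | mem F u v
... | true  | false = 1ℚ
... | true  | true  = + 1 / 4
... | false | true  = + 3 / 4
... | false | false = 0ℚ

choose : ∀ {n} → (Fin n → ℚ) → List (Fin n) → Dist (List (Fin n) × List (Fin n))
choose p [] = (1ℚ , ([] , [])) ∷ []
choose p (v ∷ vs) = concatMap (λ { (q , (inn , out)) →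
  (p v * q , (v ∷ inn , out)) ∷ ((1ℚ - p v) * q , (inn , v ∷ out)) ∷ [] }) (choose p vs)

removeAt : ∀ {n} → Fin n → List (Fin n) → List (Fin n)
removeAt u = filter (λ v → Relation.Nullary.Decidable.¬? (v ≟ u))
  where import Relation.Nullary.Decidable

-- one pivot step followed by recursion; 'fuel' bounds the number of rounds
-- (each round clusters at least the pivot, so fuel = number of unclustered
-- vertices always suffices).
pivotRun : ∀ {n} → SignedGraph n → PairSet n → ℕ → List (Fin n) → Dist (Clustering n)
pivotRun G F _ [] = (1ℚ , []) ∷ []
pivotRun G F zero (_ ∷ _) = []   -- unreachable with sufficient fuel
pivotRun G F (suc fuel) U@(x ∷ xs) =
  concatMap (λ u →
    concatMap (λ { (q , (inn , out)) →
      map (λ { (r , C) → ((+ 1 / length U) * q * r , (u ∷ inn) ∷ C) })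
          (pivotRun G F fuel out) })
      (choose (joinProb G F u) (removeAt u U)))
    U

pivotDist : ∀ {n} → SignedGraph n → PairSet n → Dist (Clustering n)
pivotDist {n} G F = pivotRun G F n (allFin n)

expectation : ∀ {A : Set} → (A → ℕ) → Dist A → ℚ
expectation f = foldr (λ { (p , a) acc → p * (+ f a / 1) + acc }) 0ℚ

expectedMistakes : ∀ {n} → SignedGraph n → PairSet n → ℚ
expectedMistakes G F = expectation (mistakes G) (pivotDist G F)

module Submission where

-- Let U be the set of unclustered vertices. A round with pivot u decides exactly the
-- pairs of U that touch the new cluster P, and leaves the pairs inside U ∖ P to the
-- recursion; by induction it therefore suffices that, in expectation over the round,
-- the disagreements on the decided pairs are at most 3/2 times the number of decided
-- pairs of F. The vertices join P independently, so the expectation for a pair {i, j}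
-- only involves the join probabilities of i and j. Averaging over the uniformly chosen
-- pivot, the terms in which the pivot is an endpoint of the pair are ≤ 0, and the
-- remaining terms group into triangles {u, i, j} taking each vertex in turn as the
-- pivot. A finite check of all sign, cover and membership patterns shows that such a
-- group is ≤ 0 unless the triangle is bad and meets no pair of F, which is excluded.

open import Defs
open import Data.Nat using (ℕ)
open import Data.Integer using (+_)
open import Data.Rational using (_/_; _≤_)

import Data.Nat as ℕ
open import Data.Nat using (zero; suc)
import Data.Nat.Properties as ℕₚ
import Data.Integer as ℤ
import Data.Integer.Properties as ℤₚ
open import Data.Bool using (Bool; true; false; _∧_; _∨_; not; if_then_else_)
open import Data.Bool.Properties using (∨-zeroʳ; ∧-identityʳ; ∧-zeroʳ; ∨-assoc; ∧-comm; T-≡)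
open import Data.Empty using (⊥-elim)
open import Data.Fin using (Fin; toℕ; _≟_)
import Data.Fin.Properties as Finₚ
open import Data.List using (List; []; _∷_; _++_; map; concatMap; length; allFin)
open import Data.List.Properties using (filter-notAll; length-tabulate)
open import Data.List.Membership.Propositional using (_∈_)
open import Data.List.Membership.Propositional.Properties using (∈-allFin)
open import Data.List.Relation.Unary.All as All using (All; []; _∷_)
open import Data.List.Relation.Unary.All.Properties using (concat⁺; gmap⁺)
open import Data.List.Relation.Unary.AllPairs using ([]; _∷_)
open import Data.List.Relation.Unary.Any as Any using (here; there)
open import Data.List.Relation.Unary.Unique.Propositional using (Unique)
open import Data.List.Relation.Unary.Unique.Propositional.Properties as Uniqueₚ using (allFin⁺)
open import Data.Product using (_×_; _,_; proj₁; proj₂)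
open import Data.Sum using (_⊎_; inj₁; inj₂)
open import Data.Rational using (ℚ; _+_; _*_; _-_; -_; 0ℚ; 1ℚ; _≤ᵇ_; toℚᵘ; nonNegative)
open import Data.Rational.Properties hiding (_≟_)
open import Data.Rational.Solver using (module +-*-Solver)
import Data.Rational.Unnormalised as ℚᵘ
import Data.Rational.Unnormalised.Properties as ℚᵘₚ
open import Function using (_∘_; id)
open import Function.Bundles using (module Equivalence)
open import Relation.Binary.PropositionalEquality
open import Relation.Nullary using (¬_; Dec; yes; no; ¬?)
open import Relation.Nullary.Decidable using (⌊_⌋; _×-dec_)

open +-*-Solver using (solve; _:+_; _:*_; _:-_; con; _:=_)

fromℕ : ℕ → ℚ
fromℕ k = + k / 1

toℚᵘ-fromℕ : ∀ k → toℚᵘ (fromℕ k) ℚᵘ.≃ ℚᵘ.mkℚᵘ (+ k) 0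
toℚᵘ-fromℕ k = toℚᵘ-fromℚᵘ (ℚᵘ.mkℚᵘ (+ k) 0)

fromℕ-+ : ∀ m n → fromℕ (m ℕ.+ n) ≡ fromℕ m + fromℕ n
fromℕ-+ m n = toℚᵘ-injective (begin
  toℚᵘ (fromℕ (m ℕ.+ n))                   ≈⟨ toℚᵘ-fromℕ (m ℕ.+ n) ⟩
  ℚᵘ.mkℚᵘ (+ (m ℕ.+ n)) 0                  ≈⟨ ℚᵘ.*≡* (cong (ℤ._* + 1) +m+n≡) ⟩
  ℚᵘ.mkℚᵘ (+ m) 0 ℚᵘ.+ ℚᵘ.mkℚᵘ (+ n) 0     ≈⟨ ℚᵘₚ.+-cong (toℚᵘ-fromℕ m) (toℚᵘ-fromℕ n) ⟨
  toℚᵘ (fromℕ m) ℚᵘ.+ toℚᵘ (fromℕ n)       ≈⟨ toℚᵘ-homo-+ (fromℕ m) (fromℕ n) ⟨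
  toℚᵘ (fromℕ m + fromℕ n)                 ∎)
  where
  open ℚᵘₚ.≃-Reasoning
  +m+n≡ : + (m ℕ.+ n) ≡ + m ℤ.* + 1 ℤ.+ + n ℤ.* + 1
  +m+n≡ = trans (ℤₚ.pos-+ m n) (sym (cong₂ ℤ._+_ (ℤₚ.*-identityʳ (+ m)) (ℤₚ.*-identityʳ (+ n))))

1/n*n≡1 : ∀ k → (+ 1 / suc k) * fromℕ (suc k) ≡ 1ℚ
1/n*n≡1 k = toℚᵘ-injective (begin
  toℚᵘ ((+ 1 / suc k) * fromℕ (suc k))                   ≈⟨ toℚᵘ-homo-* (+ 1 / suc k) (fromℕ (suc k)) ⟩
  toℚᵘ (+ 1 / suc k) ℚᵘ.* toℚᵘ (fromℕ (suc k))           ≈⟨ ℚᵘₚ.*-cong (toℚᵘ-fromℚᵘ (ℚᵘ.mkℚᵘ (+ 1) k)) (toℚᵘ-fromℕ (suc k)) ⟩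
  ℚᵘ.mkℚᵘ (+ 1) k ℚᵘ.* ℚᵘ.mkℚᵘ (+ suc k) 0               ≈⟨ ℚᵘ.*≡* 1*[1+k]≡ ⟩
  ℚᵘ.mkℚᵘ (+ 1) 0                                        ∎)
  where
  open ℚᵘₚ.≃-Reasoning
  1*[1+k]≡ : + 1 ℤ.* + suc k ℤ.* + 1 ≡ + 1 ℤ.* + (suc k ℕ.* 1)
  1*[1+k]≡ = trans (ℤₚ.*-identityʳ _) (cong (+ 1 ℤ.*_) (cong +_ (sym (ℕₚ.*-identityʳ (suc k)))))

3/2*n≡3n/2 : ∀ k → (+ 3 / 2) * fromℕ k ≡ + (3 ℕ.* k) / 2
3/2*n≡3n/2 k = toℚᵘ-injective (begin
  toℚᵘ ((+ 3 / 2) * fromℕ k)                    ≈⟨ toℚᵘ-homo-* (+ 3 / 2) (fromℕ k) ⟩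
  toℚᵘ (+ 3 / 2) ℚᵘ.* toℚᵘ (fromℕ k)            ≈⟨ ℚᵘₚ.*-cong (toℚᵘ-fromℚᵘ (ℚᵘ.mkℚᵘ (+ 3) 1)) (toℚᵘ-fromℕ k) ⟩
  ℚᵘ.mkℚᵘ (+ 3) 1 ℚᵘ.* ℚᵘ.mkℚᵘ (+ k) 0          ≈⟨ ℚᵘ.*≡* (cong (ℤ._* + 2) (sym (ℤₚ.pos-* 3 k))) ⟩
  ℚᵘ.mkℚᵘ (+ (3 ℕ.* k)) 1                       ≈⟨ toℚᵘ-fromℚᵘ (ℚᵘ.mkℚᵘ (+ (3 ℕ.* k)) 1) ⟨
  toℚᵘ (+ (3 ℕ.* k) / 2)                        ∎)
  where open ℚᵘₚ.≃-Reasoning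

0≤* : ∀ {a b} → 0ℚ ≤ a → 0ℚ ≤ b → 0ℚ ≤ a * b
0≤* {a} {b} 0≤a 0≤b = nonNegative⁻¹ (a * b) {{nonNeg*nonNeg⇒nonNeg a {{nonNegative 0≤a}} b {{nonNegative 0≤b}}}}

0≤1-p : ∀ {p} → p ≤ 1ℚ → 0ℚ ≤ 1ℚ - p
0≤1-p {p} p≤1 = ≤-trans (≤-reflexive (sym (+-inverseʳ p))) (+-monoˡ-≤ (- p) p≤1)

0≤1/n : ∀ k → 0ℚ ≤ + 1 / suc k
0≤1/n k = nonNegative⁻¹ (+ 1 / suc k) {{normalize-nonNeg 1 (suc k)}}

*-monoˡ-≤-0≤ : ∀ {r p q} → 0ℚ ≤ r → p ≤ q → r * p ≤ r * q
*-monoˡ-≤-0≤ {r} 0≤r = *-monoˡ-≤-nonNeg r {{nonNegative 0≤r}}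

x+x≤0⇒x≤0 : ∀ x → x + x ≤ 0ℚ → x ≤ 0ℚ
x+x≤0⇒x≤0 x x+x≤0 = *-cancelˡ-≤-pos (fromℕ 2) (begin
  fromℕ 2 * x   ≡⟨ solve 1 (λ x → con (fromℕ 2) :* x := x :+ x) refl x ⟩
  x + x         ≤⟨ x+x≤0 ⟩
  0ℚ            ≡⟨ *-zeroʳ (fromℕ 2) ⟨
  fromℕ 2 * 0ℚ  ∎)
  where open ≤-Reasoning

x+x+x≤0⇒x≤0 : ∀ x → x + (x + x) ≤ 0ℚ → x ≤ 0ℚ
x+x+x≤0⇒x≤0 x 3x≤0 = *-cancelˡ-≤-pos (fromℕ 3) (begin
  fromℕ 3 * x   ≡⟨ solve 1 (λ x → con (fromℕ 3) :* x := x :+ (x :+ x)) refl x ⟩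
  x + (x + x)   ≤⟨ 3x≤0 ⟩
  0ℚ            ≡⟨ *-zeroʳ (fromℕ 3) ⟨
  fromℕ 3 * 0ℚ  ∎)
  where open ≤-Reasoning

∑ : {A : Set} → List A → (A → ℚ) → ℚ
∑ []       f = 0ℚ
∑ (x ∷ xs) f = f x + ∑ xs f

∑-syntax : {A : Set} → List A → (A → ℚ) → ℚ
∑-syntax = ∑

infix 5 ∑-syntax
syntax ∑-syntax xs (λ x → e) = ∑[ x ∈ xs ] e

module _ {A : Set} where

  ∑-cong : ∀ (xs : List A) {f g : A → ℚ} → (∀ x → f x ≡ g x) → ∑ xs f ≡ ∑ xs g
  ∑-cong []       f≡g = refl
  ∑-cong (x ∷ xs) f≡g = cong₂ _+_ (f≡g x) (∑-cong xs f≡g)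

  ∑-cong-All : ∀ {P : A → Set} {xs : List A} {f g : A → ℚ} →
               All P xs → (∀ {x} → P x → f x ≡ g x) → ∑ xs f ≡ ∑ xs g
  ∑-cong-All []         f≡g = refl
  ∑-cong-All (px ∷ pxs) f≡g = cong₂ _+_ (f≡g px) (∑-cong-All pxs f≡g)

  ∑-mono-All : ∀ {P : A → Set} {xs : List A} {f g : A → ℚ} →
               All P xs → (∀ {x} → P x → f x ≤ g x) → ∑ xs f ≤ ∑ xs g
  ∑-mono-All []         f≤g = ≤-refl
  ∑-mono-All (px ∷ pxs) f≤g = +-mono-≤ (f≤g px) (∑-mono-All pxs f≤g)

  ∑-mono : ∀ (xs : List A) {f g : A → ℚ} → (∀ x → f x ≤ g x) → ∑ xs f ≤ ∑ xs g
  ∑-mono []       f≤g = ≤-refl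
  ∑-mono (x ∷ xs) f≤g = +-mono-≤ (f≤g x) (∑-mono xs f≤g)

  ∑-0 : ∀ (xs : List A) → ∑[ x ∈ xs ] 0ℚ ≡ 0ℚ
  ∑-0 []       = refl
  ∑-0 (x ∷ xs) = trans (+-identityˡ _) (∑-0 xs)

  ∑-nonPos : ∀ (xs : List A) {f : A → ℚ} → (∀ x → f x ≤ 0ℚ) → ∑ xs f ≤ 0ℚ
  ∑-nonPos xs f≤0 = ≤-trans (∑-mono xs f≤0) (≤-reflexive (∑-0 xs))

  ∑-distrib-+ : ∀ (xs : List A) (f g : A → ℚ) → ∑[ x ∈ xs ] (f x + g x) ≡ ∑ xs f + ∑ xs g
  ∑-distrib-+ []       f g = refl
  ∑-distrib-+ (x ∷ xs) f g = trans (cong (_+_ (f x + g x)) (∑-distrib-+ xs f g)) (swap (f x) (g x) _ _)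
    where
    swap : ∀ a b c d → a + b + (c + d) ≡ a + c + (b + d)
    swap = solve 4 (λ a b c d → a :+ b :+ (c :+ d) := a :+ c :+ (b :+ d)) refl

  *-distribˡ-∑ : ∀ (xs : List A) c (f : A → ℚ) → c * ∑ xs f ≡ ∑[ x ∈ xs ] c * f x
  *-distribˡ-∑ []       c f = *-zeroʳ c
  *-distribˡ-∑ (x ∷ xs) c f = trans (*-distribˡ-+ c (f x) _) (cong (_+_ (c * f x)) (*-distribˡ-∑ xs c f))

  *-distribʳ-∑ : ∀ (xs : List A) c (f : A → ℚ) → ∑ xs f * c ≡ ∑[ x ∈ xs ] f x * c
  *-distribʳ-∑ xs c f = trans (*-comm _ c) (trans (*-distribˡ-∑ xs c f) (∑-cong xs (λ x → *-comm c (f x))))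

  ∑-linear : ∀ (xs : List A) c (f g : A → ℚ) → ∑ xs f - c * ∑ xs g ≡ ∑[ x ∈ xs ] (f x - c * g x)
  ∑-linear []       c f g = cong (_-_ 0ℚ) (*-zeroʳ c)
  ∑-linear (x ∷ xs) c f g = trans (regroup (f x) (g x) _ _) (cong (_+_ (f x - c * g x)) (∑-linear xs c f g))
    where
    regroup : ∀ a b s t → a + s - c * (b + t) ≡ a - c * b + (s - c * t)
    regroup a b s t = solve 5 (λ a b s t c → a :+ s :- c :* (b :+ t) := a :- c :* b :+ (s :- c :* t)) refl a b s t c

  ∑-const : ∀ (xs : List A) c → ∑[ x ∈ xs ] c ≡ fromℕ (length xs) * c
  ∑-const []       c = sym (*-zeroˡ c)
  ∑-const (x ∷ xs) c = begin
    c + (∑[ x ∈ xs ] c)                ≡⟨ cong (_+_ c) (∑-const xs c) ⟩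
    c + fromℕ (length xs) * c          ≡⟨ solve 2 (λ c l → c :+ l :* c := (con 1ℚ :+ l) :* c) refl c (fromℕ (length xs)) ⟩
    (1ℚ + fromℕ (length xs)) * c       ≡⟨ cong (_* c) (fromℕ-+ 1 (length xs)) ⟨
    fromℕ (suc (length xs)) * c        ∎
    where open ≡-Reasoning

  ∑-++ : ∀ (xs ys : List A) (f : A → ℚ) → ∑ (xs ++ ys) f ≡ ∑ xs f + ∑ ys f
  ∑-++ []       ys f = sym (+-identityˡ _)
  ∑-++ (x ∷ xs) ys f = trans (cong (_+_ (f x)) (∑-++ xs ys f)) (sym (+-assoc (f x) _ _))

module _ {A B : Set} where

  ∑-map : ∀ (g : A → B) (xs : List A) (f : B → ℚ) → ∑ (map g xs) f ≡ ∑[ x ∈ xs ] f (g x)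
  ∑-map g []       f = refl
  ∑-map g (x ∷ xs) f = cong (_+_ (f (g x))) (∑-map g xs f)

  ∑-concatMap : ∀ (g : A → List B) (xs : List A) (f : B → ℚ) → ∑ (concatMap g xs) f ≡ ∑[ x ∈ xs ] ∑ (g x) f
  ∑-concatMap g []       f = refl
  ∑-concatMap g (x ∷ xs) f = trans (∑-++ (g x) _ f) (cong (_+_ (∑ (g x) f)) (∑-concatMap g xs f))

  ∑-comm : ∀ (xs : List A) (ys : List B) (f : A → B → ℚ) → ∑[ x ∈ xs ] ∑[ y ∈ ys ] f x y ≡ ∑[ y ∈ ys ] ∑[ x ∈ xs ] f x y
  ∑-comm []       ys f = sym (∑-0 ys)
  ∑-comm (x ∷ xs) ys f = trans (cong (_+_ (∑ ys (f x))) (∑-comm xs ys f)) (sym (∑-distrib-+ ys (f x) _))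

expectation≡∑ : ∀ {A : Set} (f : A → ℕ) (D : Dist A) → expectation f D ≡ ∑[ z ∈ D ] proj₁ z * fromℕ (f (proj₂ z))
expectation≡∑ f []      = refl
expectation≡∑ f (z ∷ D) = cong (_+_ (proj₁ z * fromℕ (f (proj₂ z)))) (expectation≡∑ f D)

⟦_⟧ : Bool → ℚ
⟦ true  ⟧ = 1ℚ
⟦ false ⟧ = 0ℚ

⟦∧⟧ : ∀ a b → ⟦ a ∧ b ⟧ ≡ ⟦ a ⟧ * ⟦ b ⟧
⟦∧⟧ true  true  = refl
⟦∧⟧ true  false = refl
⟦∧⟧ false b     = sym (*-zeroˡ ⟦ b ⟧)

⟦∨⟧ : ∀ a b → a ∧ b ≡ false → ⟦ a ∨ b ⟧ ≡ ⟦ a ⟧ + ⟦ b ⟧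
⟦∨⟧ true  false _ = refl
⟦∨⟧ false true  _ = refl
⟦∨⟧ false false _ = refl

⟦⟧*-cong : ∀ b {x y} → (b ≡ true → x ≡ y) → ⟦ b ⟧ * x ≡ ⟦ b ⟧ * y
⟦⟧*-cong true  x≡y = cong (1ℚ *_) (x≡y refl)
⟦⟧*-cong false {x} {y} _ = trans (*-zeroˡ x) (sym (*-zeroˡ y))

trues : List Bool → ℕ
trues []           = 0
trues (true ∷ bs)  = suc (trues bs)
trues (false ∷ bs) = trues bs

trues-unique : (count : List Bool → ℕ) → count [] ≡ 0 →
               (∀ bs → count (true ∷ bs) ≡ suc (count bs)) → (∀ bs → count (false ∷ bs) ≡ count bs) →
               ∀ bs → count bs ≡ trues bs
trues-unique count c[] c-true c-false = go
  where
  go : ∀ bs → count bs ≡ trues bs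
  go []           = c[]
  go (true ∷ bs)  = trans (c-true bs) (cong suc (go bs))
  go (false ∷ bs) = trans (c-false bs) (go bs)

fromℕ-trues : ∀ bs → fromℕ (trues bs) ≡ ∑ bs ⟦_⟧
fromℕ-trues []           = refl
fromℕ-trues (true ∷ bs)  = trans (fromℕ-+ 1 (trues bs)) (cong (_+_ 1ℚ) (fromℕ-trues bs))
fromℕ-trues (false ∷ bs) = trans (fromℕ-trues bs) (sym (+-identityˡ _))

∨≡true : ∀ {a b} → a ∨ b ≡ true → a ≡ true ⊎ b ≡ true
∨≡true {true}  _   = inj₁ refl
∨≡true {false} b≡t = inj₂ b≡t

∧≡true : ∀ {a b} → a ∧ b ≡ true → a ≡ true × b ≡ true
∧≡true {true} {true} _ = refl , refl

∨≡false : ∀ {a b} → a ∨ b ≡ false → a ≡ false × b ≡ false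
∨≡false {false} {false} _ = refl , refl

<ᵇ-irrefl : ∀ m → (m ℕ.<ᵇ m) ≡ false
<ᵇ-irrefl zero    = refl
<ᵇ-irrefl (suc m) = <ᵇ-irrefl m

⟦<ᵇ⟧+⟦>ᵇ⟧ : ∀ m n → m ≢ n → ⟦ m ℕ.<ᵇ n ⟧ + ⟦ n ℕ.<ᵇ m ⟧ ≡ 1ℚ
⟦<ᵇ⟧+⟦>ᵇ⟧ zero    zero    m≢n = ⊥-elim (m≢n refl)
⟦<ᵇ⟧+⟦>ᵇ⟧ zero    (suc n) _   = refl
⟦<ᵇ⟧+⟦>ᵇ⟧ (suc m) zero    _   = refl
⟦<ᵇ⟧+⟦>ᵇ⟧ (suc m) (suc n) m≢n = ⟦<ᵇ⟧+⟦>ᵇ⟧ m n (m≢n ∘ cong suc)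

BoolFun : ℕ → Set
BoolFun zero    = Bool
BoolFun (suc k) = Bool → BoolFun k

Valid : ∀ k → BoolFun k → Set
Valid zero    b = b ≡ true
Valid (suc k) f = ∀ x → Valid k (f x)

valid? : ∀ k → BoolFun k → Bool
valid? zero    b = b
valid? (suc k) f = valid? k (f true) ∧ valid? k (f false)

valid?-sound : ∀ k (f : BoolFun k) → valid? k f ≡ true → Valid k f
valid?-sound zero    b ok = ok
valid?-sound (suc k) f ok true  = valid?-sound k (f true)  (proj₁ (∧≡true ok))
valid?-sound (suc k) f ok false = valid?-sound k (f false) (proj₂ (∧≡true ok))

module _ {n : ℕ} where

  _<ᶠ_ : Fin n → Fin n → Bool
  i <ᶠ j = toℕ i ℕ.<ᵇ toℕ j

  ⌊≟⌋-refl : ∀ (x : Fin n) → ⌊ x ≟ x ⌋ ≡ true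
  ⌊≟⌋-refl x with x ≟ x
  ... | yes _   = refl
  ... | no x≢x = ⊥-elim (x≢x refl)

  ⌊≟⌋-≢ : ∀ {x y : Fin n} → x ≢ y → ⌊ x ≟ y ⌋ ≡ false
  ⌊≟⌋-≢ {x} {y} x≢y with x ≟ y
  ... | yes x≡y = ⊥-elim (x≢y x≡y)
  ... | no _    = refl

  ⌊≟⌋-true : ∀ {x y : Fin n} → ⌊ x ≟ y ⌋ ≡ true → x ≡ y
  ⌊≟⌋-true {x} {y} eq with x ≟ y
  ... | yes x≡y = x≡y

  ⌊≟⌋-sym : ∀ (i j : Fin n) → ⌊ i ≟ j ⌋ ≡ ⌊ j ≟ i ⌋
  ⌊≟⌋-sym i j with i ≟ j
  ... | yes refl = sym (⌊≟⌋-refl i)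
  ... | no i≢j   = sym (⌊≟⌋-≢ (i≢j ∘ sym))

  <ᶠ⇒≢ : ∀ {i j : Fin n} → i <ᶠ j ≡ true → i ≢ j
  <ᶠ⇒≢ {i} i<j refl with () ← trans (sym (<ᵇ-irrefl (toℕ i))) i<j

  ⟦<ᶠ⟧+⟦>ᶠ⟧ : ∀ (i j : Fin n) → ⟦ i <ᶠ j ⟧ + ⟦ j <ᶠ i ⟧ ≡ ⟦ not ⌊ i ≟ j ⌋ ⟧
  ⟦<ᶠ⟧+⟦>ᶠ⟧ i j with i ≟ j
  ... | yes refl rewrite <ᵇ-irrefl (toℕ i) = refl
  ... | no i≢j   = ⟦<ᵇ⟧+⟦>ᵇ⟧ (toℕ i) (toℕ j) (i≢j ∘ Finₚ.toℕ-injective)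

  pairFlags : (Fin n → Fin n → Bool) → List Bool
  pairFlags P = concatMap (λ i → map (λ j → (i <ᶠ j) ∧ P i j) (allFin n)) (allFin n)

  -- countPairs counts with a helper local to Defs, identified here by its defining equations.
  countPairs≡trues : (P : Fin n → Fin n → Bool) → countPairs P ≡ trues (pairFlags P)
  countPairs≡trues P with pairFlags P | trues-unique _ refl (λ _ → refl) (λ _ → refl)
  ... | bs | count≡trues = count≡trues bs

  pairSum : (Fin n → Fin n → ℚ) → ℚ
  pairSum f = ∑[ i ∈ allFin n ] ∑[ j ∈ allFin n ] ⟦ i <ᶠ j ⟧ * f i j

  countPairs≡pairSum : (P : Fin n → Fin n → Bool) → fromℕ (countPairs P) ≡ pairSum (λ i j → ⟦ P i j ⟧)
  countPairs≡pairSum P = begin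
    fromℕ (countPairs P)                                        ≡⟨ cong fromℕ (countPairs≡trues P) ⟩
    fromℕ (trues (pairFlags P))                                 ≡⟨ fromℕ-trues (pairFlags P) ⟩
    ∑ (pairFlags P) ⟦_⟧                                         ≡⟨ ∑-concatMap _ (allFin n) ⟦_⟧ ⟩
    ∑[ i ∈ allFin n ] ∑ (map (λ j → (i <ᶠ j) ∧ P i j) (allFin n)) ⟦_⟧
      ≡⟨ ∑-cong (allFin n) (λ i → trans (∑-map _ (allFin n) ⟦_⟧) (∑-cong (allFin n) (λ j → ⟦∧⟧ (i <ᶠ j) (P i j)))) ⟩
    pairSum (λ i j → ⟦ P i j ⟧)                                 ∎
    where open ≡-Reasoning

  pairSum-0 : pairSum (λ _ _ → 0ℚ) ≡ 0ℚ
  pairSum-0 = trans (∑-cong (allFin n) (λ i → trans (∑-cong (allFin n) (λ j → *-zeroʳ ⟦ i <ᶠ j ⟧)) (∑-0 (allFin n)))) (∑-0 (allFin n))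

  pairSum-cong : ∀ {f g : Fin n → Fin n → ℚ} → (∀ i j → i <ᶠ j ≡ true → f i j ≡ g i j) → pairSum f ≡ pairSum g
  pairSum-cong f≡g = ∑-cong (allFin n) (λ i → ∑-cong (allFin n) (λ j → ⟦⟧*-cong (i <ᶠ j) (f≡g i j)))

  pairSum-linear : ∀ c (f g : Fin n → Fin n → ℚ) → pairSum f - c * pairSum g ≡ pairSum (λ i j → f i j - c * g i j)
  pairSum-linear c f g =
    trans (∑-linear (allFin n) c _ _) (∑-cong (allFin n) (λ i →
      trans (∑-linear (allFin n) c _ _) (∑-cong (allFin n) (λ j → factor ⟦ i <ᶠ j ⟧ (f i j) (g i j)))))
    where
    factor : ∀ l x y → l * x - c * (l * y) ≡ l * (x - c * y)
    factor l x y = solve 4 (λ l x y c → l :* x :- c :* (l :* y) := l :* (x :- c :* y)) refl l x y c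

  ∑-pairSum : ∀ {A : Set} (ys : List A) (w : A → ℚ) (h : A → Fin n → Fin n → ℚ) →
              ∑[ y ∈ ys ] w y * pairSum (h y) ≡ pairSum (λ i j → ∑[ y ∈ ys ] w y * h y i j)
  ∑-pairSum ys w h = begin
    ∑[ y ∈ ys ] w y * pairSum (h y)
      ≡⟨ ∑-cong ys (λ y → trans (*-distribˡ-∑ (allFin n) (w y) _) (∑-cong (allFin n) (λ i → *-distribˡ-∑ (allFin n) (w y) _))) ⟩
    ∑[ y ∈ ys ] ∑[ i ∈ allFin n ] ∑[ j ∈ allFin n ] w y * (⟦ i <ᶠ j ⟧ * h y i j)
      ≡⟨ ∑-comm ys (allFin n) _ ⟩
    ∑[ i ∈ allFin n ] ∑[ y ∈ ys ] ∑[ j ∈ allFin n ] w y * (⟦ i <ᶠ j ⟧ * h y i j)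
      ≡⟨ ∑-cong (allFin n) (λ i → ∑-comm ys (allFin n) _) ⟩
    ∑[ i ∈ allFin n ] ∑[ j ∈ allFin n ] ∑[ y ∈ ys ] w y * (⟦ i <ᶠ j ⟧ * h y i j)
      ≡⟨ ∑-cong (allFin n) (λ i → ∑-cong (allFin n) (λ j → trans (∑-cong ys (λ y → swap (w y) ⟦ i <ᶠ j ⟧ (h y i j)))
                                                                 (sym (*-distribˡ-∑ ys ⟦ i <ᶠ j ⟧ _)))) ⟩
    pairSum (λ i j → ∑[ y ∈ ys ] w y * h y i j) ∎
    where
    open ≡-Reasoning
    swap : ∀ a b c → a * (b * c) ≡ b * (a * c)
    swap = solve 3 (λ a b c → a :* (b :* c) := b :* (a :* c)) refl

  pairSum-sym : ∀ (f : Fin n → Fin n → ℚ) → (∀ i j → f i j ≡ f j i) →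
                pairSum f + pairSum f ≡ ∑[ i ∈ allFin n ] ∑[ j ∈ allFin n ] ⟦ not ⌊ i ≟ j ⌋ ⟧ * f i j
  pairSum-sym f f-sym = begin
    pairSum f + pairSum f
      ≡⟨ cong (_+_ (pairSum f)) (trans (∑-comm (allFin n) (allFin n) _)
                                       (∑-cong (allFin n) (λ i → ∑-cong (allFin n) (λ j → cong (⟦ j <ᶠ i ⟧ *_) (f-sym j i))))) ⟩
    pairSum f + (∑[ i ∈ allFin n ] ∑[ j ∈ allFin n ] ⟦ j <ᶠ i ⟧ * f i j)
      ≡⟨ ∑-distrib-+ (allFin n) _ _ ⟨
    ∑[ i ∈ allFin n ] (∑[ j ∈ allFin n ] ⟦ i <ᶠ j ⟧ * f i j) + (∑[ j ∈ allFin n ] ⟦ j <ᶠ i ⟧ * f i j)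
      ≡⟨ ∑-cong (allFin n) (λ i → trans (sym (∑-distrib-+ (allFin n) _ _)) (∑-cong (allFin n) (λ j →
           trans (sym (*-distribʳ-+ (f i j) ⟦ i <ᶠ j ⟧ ⟦ j <ᶠ i ⟧)) (cong (_* f i j) (⟦<ᶠ⟧+⟦>ᶠ⟧ i j))))) ⟩
    ∑[ i ∈ allFin n ] ∑[ j ∈ allFin n ] ⟦ not ⌊ i ≟ j ⌋ ⟧ * f i j ∎
    where open ≡-Reasoning

  pairSum-distrib : ∀ {f g h : Fin n → Fin n → ℚ} → (∀ i j → f i j ≡ g i j + h i j) → pairSum f ≡ pairSum g + pairSum h
  pairSum-distrib {f} {g} {h} f≡g+h =
    trans (∑-cong (allFin n) (λ i →
      trans (∑-cong (allFin n) (λ j → trans (cong (⟦ i <ᶠ j ⟧ *_) (f≡g+h i j)) (*-distribˡ-+ ⟦ i <ᶠ j ⟧ (g i j) (h i j))))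
            (∑-distrib-+ (allFin n) _ _)))
      (∑-distrib-+ (allFin n) _ _)

  ∑³ : (Fin n → Fin n → Fin n → ℚ) → ℚ
  ∑³ t = ∑[ u ∈ allFin n ] ∑[ i ∈ allFin n ] ∑[ j ∈ allFin n ] t u i j

  ∑³-mono : ∀ {s t : Fin n → Fin n → Fin n → ℚ} → (∀ u i j → s u i j ≤ t u i j) → ∑³ s ≤ ∑³ t
  ∑³-mono s≤t = ∑-mono (allFin n) (λ u → ∑-mono (allFin n) (λ i → ∑-mono (allFin n) (λ j → s≤t u i j)))

  ∑³-nonPos : ∀ {t : Fin n → Fin n → Fin n → ℚ} → (∀ u i j → t u i j ≤ 0ℚ) → ∑³ t ≤ 0ℚ
  ∑³-nonPos t≤0 = ∑-nonPos (allFin n) (λ u → ∑-nonPos (allFin n) (λ i → ∑-nonPos (allFin n) (λ j → t≤0 u i j)))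

  ∑³-distrib-+ : ∀ (s t : Fin n → Fin n → Fin n → ℚ) → ∑³ (λ u i j → s u i j + t u i j) ≡ ∑³ s + ∑³ t
  ∑³-distrib-+ s t =
    trans (∑-cong (allFin n) (λ u →
      trans (∑-cong (allFin n) (λ i → ∑-distrib-+ (allFin n) (s u i) (t u i))) (∑-distrib-+ (allFin n) _ _)))
      (∑-distrib-+ (allFin n) _ _)

  ∑³-swap₁₂ : ∀ (t : Fin n → Fin n → Fin n → ℚ) → ∑³ (λ u i j → t i u j) ≡ ∑³ t
  ∑³-swap₁₂ t = ∑-comm (allFin n) (allFin n) (λ u i → ∑[ j ∈ allFin n ] t i u j)

  ∑³-swap₁₃ : ∀ (t : Fin n → Fin n → Fin n → ℚ) → ∑³ (λ u i j → t j i u) ≡ ∑³ t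
  ∑³-swap₁₃ t = begin
    ∑[ u ∈ allFin n ] ∑[ i ∈ allFin n ] ∑[ j ∈ allFin n ] t j i u
      ≡⟨ ∑-cong (allFin n) (λ u → ∑-comm (allFin n) (allFin n) (λ i j → t j i u)) ⟩
    ∑[ u ∈ allFin n ] ∑[ j ∈ allFin n ] ∑[ i ∈ allFin n ] t j i u
      ≡⟨ ∑-comm (allFin n) (allFin n) (λ u j → ∑[ i ∈ allFin n ] t j i u) ⟩
    ∑[ j ∈ allFin n ] ∑[ u ∈ allFin n ] ∑[ i ∈ allFin n ] t j i u
      ≡⟨ ∑-cong (allFin n) (λ j → ∑-comm (allFin n) (allFin n) (λ u i → t j i u)) ⟩
    ∑³ t ∎
    where open ≡-Reasoning

  ∑³-rotations : ∀ (t : Fin n → Fin n → Fin n → ℚ) → ∑³ (λ u i j → t u i j + (t i u j + t j i u)) ≡ ∑³ t + (∑³ t + ∑³ t)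
  ∑³-rotations t =
    trans (∑³-distrib-+ t _) (cong (_+_ (∑³ t))
      (trans (∑³-distrib-+ (λ u i j → t i u j) (λ u i j → t j i u)) (cong₂ _+_ (∑³-swap₁₂ t) (∑³-swap₁₃ t))))

  elem-here : ∀ (x : Fin n) xs → elem x (x ∷ xs) ≡ true
  elem-here x xs = cong (_∨ elem x xs) (⌊≟⌋-refl x)

  elem-∷-≢ : ∀ {x y : Fin n} ys → x ≢ y → elem x (y ∷ ys) ≡ elem x ys
  elem-∷-≢ ys x≢y = cong (_∨ elem _ ys) (⌊≟⌋-≢ x≢y)

  ∈⇒elem : ∀ {x : Fin n} {xs} → x ∈ xs → elem x xs ≡ true
  ∈⇒elem {x} {y ∷ ys} (here refl) = elem-here x ys
  ∈⇒elem {x} {y ∷ ys} (there x∈ys) = trans (cong (⌊ x ≟ y ⌋ ∨_) (∈⇒elem x∈ys)) (∨-zeroʳ _)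

  elem-allFin : ∀ (x : Fin n) → elem x (allFin n) ≡ true
  elem-allFin x = ∈⇒elem (∈-allFin x)

  All≢⇒elem-false : ∀ {x : Fin n} {xs} → All (x ≢_) xs → elem x xs ≡ false
  All≢⇒elem-false []            = refl
  All≢⇒elem-false (x≢y ∷ x≢ys) = cong₂ _∨_ (⌊≟⌋-≢ x≢y) (All≢⇒elem-false x≢ys)

  elem-false⇒All≢ : ∀ {x : Fin n} xs → elem x xs ≡ false → All (x ≢_) xs
  elem-false⇒All≢ []       _ = []
  elem-false⇒All≢ {x} (y ∷ ys) x∉ with x ≟ y
  ... | no x≢y = x≢y ∷ elem-false⇒All≢ ys x∉

  elem-removeAt : ∀ (u x : Fin n) U → elem x (removeAt u U) ≡ elem x U ∧ not ⌊ x ≟ u ⌋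
  elem-removeAt u x []       = refl
  elem-removeAt u x (y ∷ ys) with y ≟ u
  ... | yes refl = trans (elem-removeAt u x ys) (drop-head ⌊ x ≟ u ⌋ (elem x ys))
    where
    drop-head : ∀ b e → e ∧ not b ≡ (b ∨ e) ∧ not b
    drop-head true  e = ∧-zeroʳ e
    drop-head false e = refl
  ... | no y≢u = trans (cong (⌊ x ≟ y ⌋ ∨_) (elem-removeAt u x ys)) (keep-head ⌊ x ≟ y ⌋ (elem x ys) ⌊ x ≟ u ⌋ x≡y⇒x≢u)
    where
    keep-head : ∀ a e c → (a ≡ true → c ≡ false) → a ∨ (e ∧ not c) ≡ (a ∨ e) ∧ not c
    keep-head true  e c c≡false = cong not (sym (c≡false refl))
    keep-head false e c _       = refl
    x≡y⇒x≢u : ⌊ x ≟ y ⌋ ≡ true → ⌊ x ≟ u ⌋ ≡ false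
    x≡y⇒x≢u x≡y with refl ← ⌊≟⌋-true x≡y = ⌊≟⌋-≢ y≢u

  removeAt-unique : ∀ (u : Fin n) {U} → Unique U → Unique (removeAt u U)
  removeAt-unique u = Uniqueₚ.filter⁺ (λ v → ¬? (v ≟ u))

  removeAt-length< : ∀ {u : Fin n} {U} → u ∈ U → length (removeAt u U) ℕ.< length U
  removeAt-length< {u} {U} u∈U = filter-notAll (λ v → ¬? (v ≟ u)) U (Any.map (λ u≡v v≢u → v≢u (sym u≡v)) u∈U)

  ∑-delta : ∀ {W : List (Fin n)} → Unique W → ∀ {x} → x ∈ W → (f : Fin n → ℚ) → ∑[ v ∈ W ] ⟦ ⌊ v ≟ x ⌋ ⟧ * f v ≡ f x
  ∑-delta {x ∷ ys} (x∉ys ∷ _) (here refl) f = begin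
    ⟦ ⌊ x ≟ x ⌋ ⟧ * f x + (∑[ v ∈ ys ] ⟦ ⌊ v ≟ x ⌋ ⟧ * f v)
      ≡⟨ cong₂ _+_ (cong (λ b → ⟦ b ⟧ * f x) (⌊≟⌋-refl x))
                   (∑-cong-All x∉ys (λ {v} x≢v → cong (λ b → ⟦ b ⟧ * f v) (⌊≟⌋-≢ (x≢v ∘ sym)))) ⟩
    1ℚ * f x + (∑[ v ∈ ys ] 0ℚ * f v)
      ≡⟨ cong₂ _+_ (*-identityˡ (f x)) (trans (∑-cong ys (λ v → *-zeroˡ (f v))) (∑-0 ys)) ⟩
    f x + 0ℚ
      ≡⟨ +-identityʳ (f x) ⟩
    f x ∎
    where open ≡-Reasoning
  ∑-delta {y ∷ ys} (y∉ys ∷ uys) {x} (there x∈ys) f = begin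
    ⟦ ⌊ y ≟ x ⌋ ⟧ * f y + (∑[ v ∈ ys ] ⟦ ⌊ v ≟ x ⌋ ⟧ * f v)
      ≡⟨ cong₂ _+_ (cong (λ b → ⟦ b ⟧ * f y) (⌊≟⌋-≢ (All.lookup y∉ys x∈ys))) (∑-delta uys x∈ys f) ⟩
    0ℚ * f y + f x
      ≡⟨ trans (cong (_+ f x) (*-zeroˡ (f y))) (+-identityˡ (f x)) ⟩
    f x ∎
    where open ≡-Reasoning

  ∑-unique : ∀ {U : List (Fin n)} → Unique U → (f : Fin n → ℚ) → ∑ U f ≡ ∑[ v ∈ allFin n ] ⟦ elem v U ⟧ * f v
  ∑-unique {[]}     []           f = sym (trans (∑-cong (allFin n) (λ v → *-zeroˡ (f v))) (∑-0 (allFin n)))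
  ∑-unique {x ∷ xs} (x∉xs ∷ uxs) f = sym (begin
    ∑[ v ∈ allFin n ] ⟦ ⌊ v ≟ x ⌋ ∨ elem v xs ⟧ * f v
      ≡⟨ ∑-cong (allFin n) (λ v → trans (cong (_* f v) (⟦∨⟧ ⌊ v ≟ x ⌋ (elem v xs) (disjoint v)))
                                        (*-distribʳ-+ (f v) ⟦ ⌊ v ≟ x ⌋ ⟧ ⟦ elem v xs ⟧)) ⟩
    ∑[ v ∈ allFin n ] ⟦ ⌊ v ≟ x ⌋ ⟧ * f v + ⟦ elem v xs ⟧ * f v
      ≡⟨ ∑-distrib-+ (allFin n) _ _ ⟩
    (∑[ v ∈ allFin n ] ⟦ ⌊ v ≟ x ⌋ ⟧ * f v) + (∑[ v ∈ allFin n ] ⟦ elem v xs ⟧ * f v)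
      ≡⟨ cong₂ _+_ (∑-delta (allFin⁺ n) (∈-allFin x) f) (sym (∑-unique uxs f)) ⟩
    f x + ∑ xs f ∎)
    where
    open ≡-Reasoning
    disjoint : ∀ v → ⌊ v ≟ x ⌋ ∧ elem v xs ≡ false
    disjoint v with v ≟ x
    ... | yes refl = All≢⇒elem-false x∉xs
    ... | no _     = refl

  record Partition (U P O : List (Fin n)) : Set where
    field
      elem-split : ∀ v → elem v U ≡ elem v P ∨ elem v O
      disjoint   : ∀ v → elem v P ∧ elem v O ≡ false

    elem-absent : ∀ {v} → elem v U ≡ false → elem v P ≡ false × elem v O ≡ false
    elem-absent {v} v∉U = ∨≡false (trans (sym (elem-split v)) v∉U)

    ⊆ˡ : ∀ {v} → elem v P ≡ true → elem v U ≡ true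
    ⊆ˡ {v} v∈P = trans (elem-split v) (cong (_∨ elem v O) v∈P)

    ⊆ʳ : ∀ {v} → elem v O ≡ true → elem v U ≡ true
    ⊆ʳ {v} v∈O = trans (elem-split v) (trans (cong (elem v P ∨_) v∈O) (∨-zeroʳ (elem v P)))

  open Partition

  partition-∷ˡ : ∀ {v L I O} → elem v O ≡ false → Partition L I O → Partition (v ∷ L) (v ∷ I) O
  partition-∷ˡ {v} v∉O π .elem-split x = trans (cong (⌊ x ≟ v ⌋ ∨_) (elem-split π x)) (sym (∨-assoc ⌊ x ≟ v ⌋ _ _))
  partition-∷ˡ {v} v∉O π .disjoint x with x ≟ v
  ... | yes refl = v∉O
  ... | no _     = disjoint π x

  partition-∷ʳ : ∀ {v L I O} → elem v I ≡ false → Partition L I O → Partition (v ∷ L) I (v ∷ O)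
  partition-∷ʳ {v} v∉I π .elem-split x with x ≟ v
  ... | yes refl = sym (∨-zeroʳ _)
  ... | no _     = elem-split π x
  partition-∷ʳ {v} v∉I π .disjoint x with x ≟ v
  ... | yes refl = cong (_∧ true) v∉I
  ... | no _     = disjoint π x

  pivot-partition : ∀ {u : Fin n} {U I O} → u ∈ U → Partition (removeAt u U) I O → Partition U (u ∷ I) O
  pivot-partition {u} {U} {I} {O} u∈U π = record { elem-split = split ; disjoint = apart }
    where
    split : ∀ v → elem v U ≡ (⌊ v ≟ u ⌋ ∨ elem v I) ∨ elem v O
    split v with v ≟ u
    ... | yes refl = ∈⇒elem u∈U
    ... | no v≢u   = trans (sym (∧-identityʳ (elem v U)))
                          (trans (cong (λ b → elem v U ∧ not b) (sym (⌊≟⌋-≢ v≢u)))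
                                 (trans (sym (elem-removeAt u v U)) (elem-split π v)))
    apart : ∀ v → (⌊ v ≟ u ⌋ ∨ elem v I) ∧ elem v O ≡ false
    apart v with v ≟ u
    ... | yes refl = proj₂ (elem-absent π (trans (elem-removeAt u u U) (trans (cong (λ b → elem u U ∧ not b) (⌊≟⌋-refl u)) (∧-zeroʳ _))))
    ... | no _     = disjoint π v

-- Joining the pivot independently

bernoulli : ℚ → (Bool → ℚ) → ℚ
bernoulli r h = r * h true + (1ℚ - r) * h false

bernoulli-0 : ∀ h → bernoulli 0ℚ h ≡ h false
bernoulli-0 h = solve 2 (λ a b → con 0ℚ :* a :+ (con 1ℚ :- con 0ℚ) :* b := b) refl (h true) (h false)

bernoulli-comm : ∀ r s (g : Bool → Bool → ℚ) →
                 bernoulli r (λ a → bernoulli s (g a)) ≡ bernoulli s (λ b → bernoulli r (λ a → g a b))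
bernoulli-comm r s g = solve 6 (λ r s tt tf ft ff →
    r :* (s :* tt :+ (con 1ℚ :- s) :* tf) :+ (con 1ℚ :- r) :* (s :* ft :+ (con 1ℚ :- s) :* ff)
  := s :* (r :* tt :+ (con 1ℚ :- r) :* ft) :+ (con 1ℚ :- s) :* (r :* tf :+ (con 1ℚ :- r) :* ff))
  refl r s (g true true) (g true false) (g false true) (g false false)

bernoulli-cong : ∀ r {h h′ : Bool → ℚ} → (∀ a → h a ≡ h′ a) → bernoulli r h ≡ bernoulli r h′
bernoulli-cong r h≡h′ = cong₂ (λ x y → r * x + (1ℚ - r) * y) (h≡h′ true) (h≡h′ false)

Outcome : ℕ → Set
Outcome n = ℚ × (List (Fin n) × List (Fin n))

module _ {n : ℕ} where

  weight : Outcome n → ℚ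
  weight = proj₁

  joined rest : Outcome n → List (Fin n)
  joined = proj₁ ∘ proj₂
  rest   = proj₂ ∘ proj₂

  open Partition

  record Splits (L : List (Fin n)) (y : Outcome n) : Set where
    field
      weight-nonNeg : 0ℚ ≤ weight y
      partition     : Partition L (joined y) (rest y)
      rest-unique   : Unique (rest y)
      rest-length   : length (rest y) ℕ.≤ length L

  open Splits

  module Join (p : Fin n → ℚ) (0≤p : ∀ v → 0ℚ ≤ p v) (p≤1 : ∀ v → p v ≤ 1ℚ) where

    splits-∷ : ∀ {v L} y → elem v L ≡ false → Splits L y →
               All (Splits (v ∷ L)) ((p v * weight y , (v ∷ joined y , rest y)) ∷ ((1ℚ - p v) * weight y , (joined y , v ∷ rest y)) ∷ [])
    splits-∷ {v} y v∉L s = v-joins ∷ v-stays ∷ []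
      where
      v∉I = proj₁ (elem-absent (partition s) v∉L)
      v∉O = proj₂ (elem-absent (partition s) v∉L)
      v-joins : Splits (v ∷ _) (p v * weight y , (v ∷ joined y , rest y))
      v-joins .weight-nonNeg = 0≤* (0≤p v) (weight-nonNeg s)
      v-joins .partition     = partition-∷ˡ v∉O (partition s)
      v-joins .rest-unique   = rest-unique s
      v-joins .rest-length   = ℕₚ.m≤n⇒m≤1+n (rest-length s)
      v-stays : Splits (v ∷ _) ((1ℚ - p v) * weight y , (joined y , v ∷ rest y))
      v-stays .weight-nonNeg = 0≤* (0≤1-p (p≤1 v)) (weight-nonNeg s)
      v-stays .partition     = partition-∷ʳ v∉I (partition s)
      v-stays .rest-unique   = elem-false⇒All≢ (rest y) v∉O ∷ rest-unique s
      v-stays .rest-length   = ℕ.s≤s (rest-length s)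

    choose-splits : ∀ {L} → Unique L → All (Splits L) (choose p L)
    choose-splits {[]}    []          = record
      { weight-nonNeg = ≤ᵇ⇒≤ _ ; partition = record { elem-split = λ _ → refl ; disjoint = λ _ → refl }
      ; rest-unique = [] ; rest-length = ℕ.z≤n } ∷ []
    choose-splits {v ∷ L} (v∉L ∷ uL) =
      concat⁺ (gmap⁺ (λ {y} s → splits-∷ y (All≢⇒elem-false v∉L) s) (choose-splits uL))

    private
      average : ∀ a q x → a * q * x + ((1ℚ - a) * q * x + 0ℚ) ≡ q * x
      average = solve 3 (λ a q x → a :* q :* x :+ ((con 1ℚ :- a) :* q :* x :+ con 0ℚ) := q :* x) refl

      mix : ∀ a q x y → a * q * x + ((1ℚ - a) * q * y + 0ℚ) ≡ a * (q * x) + (1ℚ - a) * (q * y)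
      mix = solve 4 (λ a q x y → a :* q :* x :+ ((con 1ℚ :- a) :* q :* y :+ con 0ℚ) := a :* (q :* x) :+ (con 1ℚ :- a) :* (q :* y)) refl

    choose-mass : ∀ L → ∑ (choose p L) weight ≡ 1ℚ
    choose-mass []      = +-identityʳ 1ℚ
    choose-mass (v ∷ L) = begin
      ∑ (choose p (v ∷ L)) weight                                           ≡⟨ ∑-concatMap _ (choose p L) weight ⟩
      ∑[ y ∈ choose p L ] p v * weight y + ((1ℚ - p v) * weight y + 0ℚ)     ≡⟨ ∑-cong (choose p L) (λ y → split (p v) (weight y)) ⟩
      ∑ (choose p L) weight                                                 ≡⟨ choose-mass L ⟩
      1ℚ                                                                    ∎
      where
      open ≡-Reasoning
      split : ∀ a q → a * q + ((1ℚ - a) * q + 0ℚ) ≡ q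
      split = solve 2 (λ a q → a :* q :+ ((con 1ℚ :- a) :* q :+ con 0ℚ) := q) refl

    marginal : List (Fin n) → Fin n → ℚ
    marginal L v = if elem v L then p v else 0ℚ

    choose-single : ∀ {L} → Unique L → ∀ j (h : Bool → ℚ) →
                    ∑[ y ∈ choose p L ] weight y * h (elem j (joined y)) ≡ bernoulli (marginal L j) h
    choose-single {[]}    []         j h = trans (+-identityʳ _) (trans (*-identityˡ _) (sym (bernoulli-0 h)))
    choose-single {v ∷ L} (v∉L ∷ uL) j h with j ≟ v
    ... | no j≢v = begin
      ∑[ y ∈ choose p (v ∷ L) ] weight y * h (elem j (joined y))
        ≡⟨ ∑-concatMap _ (choose p L) _ ⟩
      ∑[ y ∈ choose p L ] p v * weight y * h (elem j (v ∷ joined y)) + ((1ℚ - p v) * weight y * h (elem j (joined y)) + 0ℚ)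
        ≡⟨ ∑-cong (choose p L) (λ y →
             trans (cong (λ b → p v * weight y * h b + ((1ℚ - p v) * weight y * h (elem j (joined y)) + 0ℚ))
                         (elem-∷-≢ (joined y) j≢v))
                   (average (p v) (weight y) (h (elem j (joined y))))) ⟩
      ∑[ y ∈ choose p L ] weight y * h (elem j (joined y))
        ≡⟨ choose-single uL j h ⟩
      bernoulli (marginal L j) h ∎
      where open ≡-Reasoning
    ... | yes refl = begin
      ∑[ y ∈ choose p (v ∷ L) ] weight y * h (elem v (joined y))
        ≡⟨ ∑-concatMap _ (choose p L) _ ⟩
      ∑[ y ∈ choose p L ] p v * weight y * h (elem v (v ∷ joined y)) + ((1ℚ - p v) * weight y * h (elem v (joined y)) + 0ℚ)
        ≡⟨ ∑-cong-All (choose-splits uL) (λ {y} s →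
             cong₂ (λ a b → p v * weight y * h a + ((1ℚ - p v) * weight y * h b + 0ℚ))
                   (elem-here v (joined y)) (proj₁ (elem-absent (partition s) (All≢⇒elem-false v∉L)))) ⟩
      ∑[ y ∈ choose p L ] p v * weight y * h true + ((1ℚ - p v) * weight y * h false + 0ℚ)
        ≡⟨ ∑-cong (choose p L) (λ y → regroup (p v) (weight y) (h true) (h false)) ⟩
      ∑[ y ∈ choose p L ] weight y * bernoulli (p v) h
        ≡⟨ *-distribʳ-∑ (choose p L) _ weight ⟨
      ∑ (choose p L) weight * bernoulli (p v) h
        ≡⟨ trans (cong (_* _) (choose-mass L)) (*-identityˡ _) ⟩
      bernoulli (p v) h ∎
      where
      open ≡-Reasoning
      regroup : ∀ a q x y → a * q * x + ((1ℚ - a) * q * y + 0ℚ) ≡ q * (a * x + (1ℚ - a) * y)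
      regroup = solve 4 (λ a q x y → a :* q :* x :+ ((con 1ℚ :- a) :* q :* y :+ con 0ℚ) := q :* (a :* x :+ (con 1ℚ :- a) :* y)) refl

    choose-pair-head : ∀ {v L} → All (v ≢_) L → Unique L → ∀ {j} → j ≢ v → (g : Bool → Bool → ℚ) →
                  ∑[ y ∈ choose p (v ∷ L) ] weight y * g (elem v (joined y)) (elem j (joined y))
                    ≡ bernoulli (p v) (λ a → bernoulli (marginal L j) (g a))
    choose-pair-head {v} {L} v∉L uL {j} j≢v g = begin
      ∑[ y ∈ choose p (v ∷ L) ] weight y * g (elem v (joined y)) (elem j (joined y))
        ≡⟨ ∑-concatMap _ (choose p L) _ ⟩
      ∑[ y ∈ choose p L ] p v * weight y * g (elem v (v ∷ joined y)) (elem j (v ∷ joined y))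
                          + ((1ℚ - p v) * weight y * g (elem v (joined y)) (elem j (joined y)) + 0ℚ)
        ≡⟨ ∑-cong-All (choose-splits uL) v-decided ⟩
      ∑[ y ∈ choose p L ] p v * (weight y * g true (elem j (joined y))) + (1ℚ - p v) * (weight y * g false (elem j (joined y)))
        ≡⟨ ∑-distrib-+ (choose p L) _ _ ⟩
      (∑[ y ∈ choose p L ] p v * (weight y * g true (elem j (joined y))))
        + (∑[ y ∈ choose p L ] (1ℚ - p v) * (weight y * g false (elem j (joined y))))
        ≡⟨ cong₂ _+_ (*-distribˡ-∑ (choose p L) (p v) _) (*-distribˡ-∑ (choose p L) (1ℚ - p v) _) ⟨
      p v * (∑[ y ∈ choose p L ] weight y * g true (elem j (joined y)))
        + (1ℚ - p v) * (∑[ y ∈ choose p L ] weight y * g false (elem j (joined y)))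
        ≡⟨ cong₂ (λ s t → p v * s + (1ℚ - p v) * t) (choose-single uL j (g true)) (choose-single uL j (g false)) ⟩
      bernoulli (p v) (λ a → bernoulli (marginal L j) (g a)) ∎
      where
      open ≡-Reasoning
      v-decided : ∀ {y} → Splits L y →
        p v * weight y * g (elem v (v ∷ joined y)) (elem j (v ∷ joined y))
          + ((1ℚ - p v) * weight y * g (elem v (joined y)) (elem j (joined y)) + 0ℚ)
        ≡ p v * (weight y * g true (elem j (joined y))) + (1ℚ - p v) * (weight y * g false (elem j (joined y)))
      v-decided {y} s rewrite elem-here v (joined y) | elem-∷-≢ (joined y) j≢v
                            | proj₁ (elem-absent (partition s) (All≢⇒elem-false v∉L)) = mix (p v) (weight y) _ _

    choose-pair : ∀ {L} → Unique L → ∀ {i j} → i ≢ j → (g : Bool → Bool → ℚ) →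
                  ∑[ y ∈ choose p L ] weight y * g (elem i (joined y)) (elem j (joined y))
                    ≡ bernoulli (marginal L i) (λ a → bernoulli (marginal L j) (g a))
    choose-pair {[]} [] _ g = begin
      1ℚ * g false false + 0ℚ                  ≡⟨ trans (+-identityʳ _) (*-identityˡ _) ⟩
      g false false                            ≡⟨ bernoulli-0 (g false) ⟨
      bernoulli 0ℚ (g false)                   ≡⟨ bernoulli-0 (λ a → bernoulli 0ℚ (g a)) ⟨
      bernoulli 0ℚ (λ a → bernoulli 0ℚ (g a)) ∎
      where open ≡-Reasoning
    choose-pair {v ∷ L} (v∉L ∷ uL) {i} {j} i≢j g with i ≟ v | j ≟ v
    ... | yes refl | yes refl = ⊥-elim (i≢j refl)
    ... | yes refl | no j≢v   = choose-pair-head v∉L uL j≢v g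
    ... | no i≢v   | yes refl = trans (choose-pair-head v∉L uL i≢v (λ b a → g a b)) (bernoulli-comm (p v) (marginal L i) (λ b a → g a b))
    ... | no i≢v   | no j≢v   = begin
      ∑[ y ∈ choose p (v ∷ L) ] weight y * g (elem i (joined y)) (elem j (joined y))
        ≡⟨ ∑-concatMap _ (choose p L) _ ⟩
      ∑[ y ∈ choose p L ] p v * weight y * g (elem i (v ∷ joined y)) (elem j (v ∷ joined y))
                          + ((1ℚ - p v) * weight y * g (elem i (joined y)) (elem j (joined y)) + 0ℚ)
        ≡⟨ ∑-cong (choose p L) v-irrelevant ⟩
      ∑[ y ∈ choose p L ] weight y * g (elem i (joined y)) (elem j (joined y))
        ≡⟨ choose-pair uL i≢j g ⟩
      bernoulli (marginal L i) (λ a → bernoulli (marginal L j) (g a)) ∎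
      where
      open ≡-Reasoning
      v-irrelevant : ∀ y →
        p v * weight y * g (elem i (v ∷ joined y)) (elem j (v ∷ joined y))
          + ((1ℚ - p v) * weight y * g (elem i (joined y)) (elem j (joined y)) + 0ℚ)
        ≡ weight y * g (elem i (joined y)) (elem j (joined y))
      v-irrelevant y rewrite elem-∷-≢ (joined y) i≢v | elem-∷-≢ (joined y) j≢v = average (p v) (weight y) _

-- Accounting for one pair in one round

3/2 : ℚ
3/2 = + 3 / 2

joinRate : (positive inF : Bool) → ℚ
joinRate true  false = 1ℚ
joinRate true  true  = + 1 / 4
joinRate false true  = + 3 / 4
joinRate false false = 0ℚ

0≤joinRate : ∀ s f → 0ℚ ≤ joinRate s f
0≤joinRate true  false = ≤ᵇ⇒≤ _
0≤joinRate true  true  = ≤ᵇ⇒≤ _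
0≤joinRate false true  = ≤ᵇ⇒≤ _
0≤joinRate false false = ≤ᵇ⇒≤ _

joinRate≤1 : ∀ s f → joinRate s f ≤ 1ℚ
joinRate≤1 true  false = ≤ᵇ⇒≤ _
joinRate≤1 true  true  = ≤ᵇ⇒≤ _
joinRate≤1 false true  = ≤ᵇ⇒≤ _
joinRate≤1 false false = ≤ᵇ⇒≤ _

disagree : (positive together : Bool) → Bool
disagree s c = (s ∧ not c) ∨ (not s ∧ c)

cluster-split : ∀ (d : Bool → Bool) pᵢ oᵢ pⱼ oⱼ s →
                pᵢ ∧ oᵢ ≡ false → pⱼ ∧ oⱼ ≡ false → (s ≡ true → oᵢ ∧ oⱼ ≡ true) →
                ⟦ ((pᵢ ∨ oᵢ) ∧ (pⱼ ∨ oⱼ)) ∧ d ((pᵢ ∧ pⱼ) ∨ s) ⟧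
                  ≡ ⟦ (oᵢ ∧ oⱼ) ∧ d s ⟧ + ⟦ (((pᵢ ∨ oᵢ) ∧ (pⱼ ∨ oⱼ)) ∧ (pᵢ ∨ pⱼ)) ∧ d (pᵢ ∧ pⱼ) ⟧
cluster-split d true  true  _     _     _     () _  _
cluster-split d _     _     true  true  _     _  () _
cluster-split d true  false true  false s     _  _  _  = sym (+-identityˡ _)
cluster-split d true  false false true  false _  _  _  = sym (+-identityˡ _)
cluster-split d true  false false true  true  _  _  s⇒ with () ← s⇒ refl
cluster-split d true  false false false s     _  _  _  = refl
cluster-split d false true  true  false false _  _  _  = sym (+-identityˡ _)
cluster-split d false true  true  false true  _  _  s⇒ with () ← s⇒ refl
cluster-split d false true  false true  s     _  _  _  = sym (+-identityʳ _)
cluster-split d false true  false false s     _  _  _  = refl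
cluster-split d false false pⱼ    oⱼ    s     _  _  _  = refl

-- A pair decided in the round costs its disagreement minus a budget of 3/2 if it lies in F;
-- a, b say whether its endpoints are in the new cluster.
excess : (positive inF inPᵢ inPⱼ : Bool) → ℚ
excess s f a b = ⟦ (a ∨ b) ∧ disagree s (a ∧ b) ⟧ - 3/2 * ⟦ (a ∨ b) ∧ f ⟧

excess-sym : ∀ s f a b → excess s f a b ≡ excess s f b a
excess-sym s f true  true  = refl
excess-sym s f true  false = refl
excess-sym s f false true  = refl
excess-sym s f false false = refl

joinChance : (unclustered isPivot positive inF : Bool) → ℚ
joinChance u c s f = if u ∧ not c then joinRate s f else 0ℚ

-- The expected excess of a pair {i, j} in a round: uᵢ, uⱼ say whether i, j are unclustered,
-- cᵢ, cⱼ whether they are the pivot, (s, f) give the sign of ij and whether it lies in F,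
-- and (sᵢ, fᵢ), (sⱼ, fⱼ) the same for the edges from the pivot to i and to j.
pairTerm : (uᵢ uⱼ cᵢ cⱼ s f sᵢ fᵢ sⱼ fⱼ : Bool) → ℚ
pairTerm uᵢ uⱼ cᵢ cⱼ s f sᵢ fᵢ sⱼ fⱼ =
  ⟦ uᵢ ∧ uⱼ ⟧ * bernoulli (joinChance uᵢ cᵢ sᵢ fᵢ) (λ a →
                 bernoulli (joinChance uⱼ cⱼ sⱼ fⱼ) (λ b → excess s f (cᵢ ∨ a) (cⱼ ∨ b)))

pairTerm-sym : ∀ uᵢ uⱼ cᵢ cⱼ s f sᵢ fᵢ sⱼ fⱼ →
               pairTerm uᵢ uⱼ cᵢ cⱼ s f sᵢ fᵢ sⱼ fⱼ ≡ pairTerm uⱼ uᵢ cⱼ cᵢ s f sⱼ fⱼ sᵢ fᵢ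
pairTerm-sym uᵢ uⱼ cᵢ cⱼ s f sᵢ fᵢ sⱼ fⱼ = cong₂ _*_ (cong ⟦_⟧ (∧-comm uᵢ uⱼ)) (begin
  bernoulli rᵢ (λ a → bernoulli rⱼ (λ b → excess s f (cᵢ ∨ a) (cⱼ ∨ b)))
    ≡⟨ bernoulli-comm rᵢ rⱼ (λ a b → excess s f (cᵢ ∨ a) (cⱼ ∨ b)) ⟩
  bernoulli rⱼ (λ b → bernoulli rᵢ (λ a → excess s f (cᵢ ∨ a) (cⱼ ∨ b)))
    ≡⟨ bernoulli-cong rⱼ (λ b → bernoulli-cong rᵢ (λ a → excess-sym s f (cᵢ ∨ a) (cⱼ ∨ b))) ⟩
  bernoulli rⱼ (λ b → bernoulli rᵢ (λ a → excess s f (cⱼ ∨ b) (cᵢ ∨ a))) ∎)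
  where
  open ≡-Reasoning
  rᵢ = joinChance uᵢ cᵢ sᵢ fᵢ
  rⱼ = joinChance uⱼ cⱼ sⱼ fⱼ

pivotTermᵇ : (uₚ uᵢ uⱼ cᵢ cⱼ dᵢⱼ s f sᵢ fᵢ sⱼ fⱼ : Bool) → ℚ
pivotTermᵇ uₚ uᵢ uⱼ cᵢ cⱼ dᵢⱼ s f sᵢ fᵢ sⱼ fⱼ = ⟦ uₚ ⟧ * (⟦ dᵢⱼ ⟧ * pairTerm uᵢ uⱼ cᵢ cⱼ s f sᵢ fᵢ sⱼ fⱼ)

-- The three choices of pivot in a triangle u, i, j whose edges ui, ij, uj are numbered 1, 2, 3.
triangleSum : (uᵤ uᵢ uⱼ s₁ f₁ s₂ f₂ s₃ f₃ : Bool) → ℚ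
triangleSum uᵤ uᵢ uⱼ s₁ f₁ s₂ f₂ s₃ f₃ =
  pivotTermᵇ uᵤ uᵢ uⱼ false false true s₂ f₂ s₁ f₁ s₃ f₃
  + (pivotTermᵇ uᵢ uᵤ uⱼ false false true s₃ f₃ s₁ f₁ s₂ f₂
  + pivotTermᵇ uⱼ uᵢ uᵤ false false true s₁ f₁ s₂ f₂ s₃ f₃)

uncoveredBad : (s₁ s₂ s₃ f₁ f₂ f₃ : Bool) → Bool
uncoveredBad s₁ s₂ s₃ f₁ f₂ f₃ = not (f₁ ∨ f₂ ∨ f₃) ∧ (nFalse (s₁ ∷ s₂ ∷ s₃ ∷ []) ℕ.≡ᵇ 1)

endpoint-valid : Valid 6 (λ uₚ uⱼ s f sₚ fₚ → pivotTermᵇ uₚ uₚ uⱼ true false true s f sₚ fₚ s f ≤ᵇ 0ℚ)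
endpoint-valid = valid?-sound 6 _ refl

triangle-valid : Valid 9 (λ uᵤ uᵢ uⱼ s₁ f₁ s₂ f₂ s₃ f₃ →
                   (triangleSum uᵤ uᵢ uⱼ s₁ f₁ s₂ f₂ s₃ f₃ ≤ᵇ 0ℚ) ∨ uncoveredBad s₁ s₂ s₃ f₁ f₂ f₃)
triangle-valid = valid?-sound 9 _ refl

endpoint-nonPos : ∀ uₚ uⱼ s f sₚ fₚ → pivotTermᵇ uₚ uₚ uⱼ true false true s f sₚ fₚ s f ≤ 0ℚ
endpoint-nonPos uₚ uⱼ s f sₚ fₚ = ≤ᵇ⇒≤ (Equivalence.from T-≡ (endpoint-valid uₚ uⱼ s f sₚ fₚ))

uncoveredBad-false : ∀ s₁ s₂ s₃ f₁ f₂ f₃ →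
                     (nFalse (s₁ ∷ s₂ ∷ s₃ ∷ []) ≡ 1 → f₁ ≡ true ⊎ f₂ ≡ true ⊎ f₃ ≡ true) →
                     uncoveredBad s₁ s₂ s₃ f₁ f₂ f₃ ≡ false
uncoveredBad-false _ _ _ true  _     _     _ = refl
uncoveredBad-false _ _ _ false true  _     _ = refl
uncoveredBad-false _ _ _ false false true  _ = refl
uncoveredBad-false s₁ s₂ s₃ false false false covered with nFalse (s₁ ∷ s₂ ∷ s₃ ∷ []) ℕ.≡ᵇ 1 in bad
... | false = refl
... | true with covered (ℕₚ.≡ᵇ⇒≡ _ 1 (Equivalence.from T-≡ bad))
...   | inj₁ ()
...   | inj₂ (inj₁ ())
...   | inj₂ (inj₂ ())

triangleSum-nonPos : ∀ uᵤ uᵢ uⱼ s₁ f₁ s₂ f₂ s₃ f₃ →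
                     (nFalse (s₁ ∷ s₂ ∷ s₃ ∷ []) ≡ 1 → f₁ ≡ true ⊎ f₂ ≡ true ⊎ f₃ ≡ true) →
                     triangleSum uᵤ uᵢ uⱼ s₁ f₁ s₂ f₂ s₃ f₃ ≤ 0ℚ
triangleSum-nonPos uᵤ uᵢ uⱼ s₁ f₁ s₂ f₂ s₃ f₃ covered
  with triangleSum uᵤ uᵢ uⱼ s₁ f₁ s₂ f₂ s₃ f₃ ≤ᵇ 0ℚ in nonPos | triangle-valid uᵤ uᵢ uⱼ s₁ f₁ s₂ f₂ s₃ f₃
... | true  | _   = ≤ᵇ⇒≤ (Equivalence.from T-≡ nonPos)
... | false | bad with () ← trans (sym bad) (uncoveredBad-false s₁ s₂ s₃ f₁ f₂ f₃ covered)

-- The pivot algorithm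

module Analysis {n : ℕ} (G : SignedGraph n) (F : PairSet n) where

  open Partition
  open Splits

  joinProb≡joinRate : ∀ u v → joinProb G F u v ≡ joinRate (pos G u v) (mem F u v)
  joinProb≡joinRate u v with pos G u v | mem F u v
  ... | true  | true  = refl
  ... | true  | false = refl
  ... | false | true  = refl
  ... | false | false = refl

  module Round (u : Fin n) = Join (joinProb G F u)
    (λ v → subst (0ℚ ≤_) (sym (joinProb≡joinRate u v)) (0≤joinRate (pos G u v) (mem F u v)))
    (λ v → subst (_≤ 1ℚ) (sym (joinProb≡joinRate u v)) (joinRate≤1 (pos G u v) (mem F u v)))

  outcomes : Fin n → List (Fin n) → List (Outcome n)
  outcomes u U = choose (joinProb G F u) (removeAt u U)

  inside : List (Fin n) → Fin n → Fin n → Bool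
  inside U i j = elem i U ∧ elem j U

  touches : List (Fin n) → Fin n → Fin n → Bool
  touches P i j = elem i P ∨ elem j P

  cost : List (Fin n) → Clustering n → ℚ
  cost U C = pairSum (λ i j → ⟦ inside U i j ∧ disagree (pos G i j) (sameCluster C i j) ⟧)

  coverIn : List (Fin n) → ℚ
  coverIn U = pairSum (λ i j → ⟦ inside U i j ∧ mem F i j ⟧)

  excess-in : List (Fin n) → Fin n → Fin n → ℚ
  excess-in P i j = excess (pos G i j) (mem F i j) (elem i P) (elem j P)

  roundCost roundCover roundExcess : List (Fin n) → List (Fin n) → ℚ
  roundCost   U P = pairSum (λ i j → ⟦ (inside U i j ∧ touches P i j) ∧ disagree (pos G i j) (inside P i j) ⟧)
  roundCover  U P = pairSum (λ i j → ⟦ (inside U i j ∧ touches P i j) ∧ mem F i j ⟧)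
  roundExcess U P = pairSum (λ i j → ⟦ inside U i j ⟧ * excess-in P i j)

  inside-allFin : ∀ i j → inside (allFin n) i j ≡ true
  inside-allFin i j = cong₂ _∧_ (elem-allFin i) (elem-allFin j)

  mistakes≡cost : ∀ C → fromℕ (mistakes G C) ≡ cost (allFin n) C
  mistakes≡cost C = trans (countPairs≡pairSum (λ i j → disagree (pos G i j) (sameCluster C i j))) (pairSum-cong (λ i j _ →
    cong (λ b → ⟦ b ∧ disagree (pos G i j) (sameCluster C i j) ⟧) (sym (inside-allFin i j))))

  card≡coverIn : fromℕ (card F) ≡ coverIn (allFin n)
  card≡coverIn = trans (countPairs≡pairSum (mem F)) (pairSum-cong (λ i j _ →
    cong (λ b → ⟦ b ∧ mem F i j ⟧) (sym (inside-allFin i j))))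

  Within : List (Fin n) → Clustering n → Set
  Within O C = ∀ i j → sameCluster C i j ≡ true → inside O i j ≡ true

  cost-split : ∀ {U P O C} → Partition U P O → Within O C → cost U (P ∷ C) ≡ cost O C + roundCost U P
  cost-split {U} {P} {O} {C} π within = pairSum-distrib pointwise
    where
    pointwise : ∀ i j → ⟦ inside U i j ∧ disagree (pos G i j) (sameCluster (P ∷ C) i j) ⟧
                        ≡ ⟦ inside O i j ∧ disagree (pos G i j) (sameCluster C i j) ⟧
                          + ⟦ (inside U i j ∧ touches P i j) ∧ disagree (pos G i j) (inside P i j) ⟧
    pointwise i j rewrite elem-split π i | elem-split π j =
      cluster-split (disagree (pos G i j)) (elem i P) (elem i O) (elem j P) (elem j O) (sameCluster C i j) (disjoint π i) (disjoint π j) (within i j)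

  coverIn-split : ∀ {U P O} → Partition U P O → coverIn U ≡ coverIn O + roundCover U P
  coverIn-split {U} {P} {O} π = pairSum-distrib pointwise
    where
    pointwise : ∀ i j → ⟦ inside U i j ∧ mem F i j ⟧ ≡ ⟦ inside O i j ∧ mem F i j ⟧ + ⟦ (inside U i j ∧ touches P i j) ∧ mem F i j ⟧
    pointwise i j rewrite elem-split π i | elem-split π j =
      cluster-split (λ _ → mem F i j) (elem i P) (elem i O) (elem j P) (elem j O) false (disjoint π i) (disjoint π j) (λ ())

  roundCost-roundCover : ∀ U P → roundCost U P - 3/2 * roundCover U P ≡ roundExcess U P
  roundCost-roundCover U P =
    trans (pairSum-linear 3/2 (λ i j → ⟦ (inside U i j ∧ touches P i j) ∧ disagree (pos G i j) (inside P i j) ⟧)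
                              (λ i j → ⟦ (inside U i j ∧ touches P i j) ∧ mem F i j ⟧))
          (pairSum-cong (λ i j _ → factor (inside U i j) (touches P i j) (disagree (pos G i j) (inside P i j)) (mem F i j)))
    where
    factor : ∀ b t x f → ⟦ (b ∧ t) ∧ x ⟧ - 3/2 * ⟦ (b ∧ t) ∧ f ⟧ ≡ ⟦ b ⟧ * (⟦ t ∧ x ⟧ - 3/2 * ⟦ t ∧ f ⟧)
    factor true  t x f = sym (*-identityˡ (⟦ t ∧ x ⟧ - 3/2 * ⟦ t ∧ f ⟧))
    factor false t x f = sym (*-zeroˡ (⟦ t ∧ x ⟧ - 3/2 * ⟦ t ∧ f ⟧))

  module Charging (cover : IsBadTriangleCover G F) {U : List (Fin n)} (uniqueU : Unique U) where

    expectedExcess : Fin n → Fin n → Fin n → ℚ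
    expectedExcess u i j =
      pairTerm (elem i U) (elem j U) ⌊ i ≟ u ⌋ ⌊ j ≟ u ⌋ (pos G i j) (mem F i j) (pos G u i) (mem F u i) (pos G u j) (mem F u j)

    marginal≡joinChance : ∀ u v → Round.marginal u (removeAt u U) v ≡ joinChance (elem v U) ⌊ v ≟ u ⌋ (pos G u v) (mem F u v)
    marginal≡joinChance u v = cong₂ (λ b r → if b then r else 0ℚ) (elem-removeAt u v U) (joinProb≡joinRate u v)

    round-expectation : ∀ u → ∑[ y ∈ outcomes u U ] weight y * roundExcess U (u ∷ joined y) ≡ pairSum (expectedExcess u)
    round-expectation u =
      trans (∑-pairSum (outcomes u U) weight (λ y i j → ⟦ inside U i j ⟧ * excess-in (u ∷ joined y) i j)) (pairSum-cong pair)
      where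
      pair : ∀ i j → i <ᶠ j ≡ true →
             ∑[ y ∈ outcomes u U ] weight y * (⟦ inside U i j ⟧ * excess-in (u ∷ joined y) i j) ≡ expectedExcess u i j
      pair i j i<j = begin
        ∑[ y ∈ outcomes u U ] weight y * (⟦ inside U i j ⟧ * e (elem i (joined y)) (elem j (joined y)))
          ≡⟨ ∑-cong (outcomes u U) (λ y → swap (weight y) ⟦ inside U i j ⟧ _) ⟩
        ∑[ y ∈ outcomes u U ] ⟦ inside U i j ⟧ * (weight y * e (elem i (joined y)) (elem j (joined y)))
          ≡⟨ *-distribˡ-∑ (outcomes u U) ⟦ inside U i j ⟧ _ ⟨
        ⟦ inside U i j ⟧ * (∑[ y ∈ outcomes u U ] weight y * e (elem i (joined y)) (elem j (joined y)))
          ≡⟨ cong (⟦ inside U i j ⟧ *_) (Round.choose-pair u (removeAt-unique u uniqueU) (<ᶠ⇒≢ i<j) e) ⟩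
        ⟦ inside U i j ⟧ * bernoulli (Round.marginal u (removeAt u U) i) (λ a → bernoulli (Round.marginal u (removeAt u U) j) (e a))
          ≡⟨ cong₂ (λ r s → ⟦ inside U i j ⟧ * bernoulli r (λ a → bernoulli s (e a)))
                   (marginal≡joinChance u i) (marginal≡joinChance u j) ⟩
        expectedExcess u i j ∎
        where
        open ≡-Reasoning
        e : Bool → Bool → ℚ
        e a b = excess (pos G i j) (mem F i j) (⌊ i ≟ u ⌋ ∨ a) (⌊ j ≟ u ⌋ ∨ b)
        swap : ∀ a b c → a * (b * c) ≡ b * (a * c)
        swap = solve 3 (λ a b c → a :* (b :* c) := b :* (a :* c)) refl

    expectedExcess-sym : ∀ u i j → expectedExcess u i j ≡ expectedExcess u j i
    expectedExcess-sym u i j rewrite pos-sym G i j | mem-sym F i j =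
      pairTerm-sym (elem i U) (elem j U) ⌊ i ≟ u ⌋ ⌊ j ≟ u ⌋ (pos G j i) (mem F j i) (pos G u i) (mem F u i) (pos G u j) (mem F u j)

    pivotTerm : Fin n → Fin n → Fin n → ℚ
    pivotTerm u i j = ⟦ elem u U ⟧ * (⟦ not ⌊ i ≟ j ⌋ ⟧ * expectedExcess u i j)

    pivotTerm-sym : ∀ u i j → pivotTerm u i j ≡ pivotTerm u j i
    pivotTerm-sym u i j = cong (⟦ elem u U ⟧ *_) (cong₂ (λ b x → ⟦ not b ⟧ * x) (⌊≟⌋-sym i j) (expectedExcess-sym u i j))

    pivotTerm-diagonal : ∀ u i → pivotTerm u i i ≡ 0ℚ
    pivotTerm-diagonal u i rewrite ⌊≟⌋-refl i =
      trans (cong (⟦ elem u U ⟧ *_) (*-zeroˡ (expectedExcess u i i))) (*-zeroʳ ⟦ elem u U ⟧)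

    pivotTerm-endpoint : ∀ u j → j ≢ u → pivotTerm u u j ≤ 0ℚ
    pivotTerm-endpoint u j j≢u rewrite ⌊≟⌋-refl u | ⌊≟⌋-≢ j≢u | ⌊≟⌋-≢ (j≢u ∘ sym) =
      endpoint-nonPos (elem u U) (elem j U) (pos G u j) (mem F u j) (pos G u u) (mem F u u)

    Distinct3 : Fin n → Fin n → Fin n → Set
    Distinct3 u i j = u ≢ i × u ≢ j × i ≢ j

    distinct3? : ∀ u i j → Dec (Distinct3 u i j)
    distinct3? u i j = ¬? (u ≟ i) ×-dec ¬? (u ≟ j) ×-dec ¬? (i ≟ j)

    nondegenerate : Fin n → Fin n → Fin n → ℚ
    nondegenerate u i j = if ⌊ distinct3? u i j ⌋ then pivotTerm u i j else 0ℚ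

    nondegenerate-distinct : ∀ {u i j} → Distinct3 u i j → nondegenerate u i j ≡ pivotTerm u i j
    nondegenerate-distinct {u} {i} {j} d = by-cases (distinct3? u i j)
      where
      by-cases : (d? : Dec (Distinct3 u i j)) → (if ⌊ d? ⌋ then pivotTerm u i j else 0ℚ) ≡ pivotTerm u i j
      by-cases (yes _) = refl
      by-cases (no ¬d) = ⊥-elim (¬d d)

    nondegenerate-degenerate : ∀ {u i j} → ¬ Distinct3 u i j → nondegenerate u i j ≡ 0ℚ
    nondegenerate-degenerate {u} {i} {j} ¬d = by-cases (distinct3? u i j)
      where
      by-cases : (d? : Dec (Distinct3 u i j)) → (if ⌊ d? ⌋ then pivotTerm u i j else 0ℚ) ≡ 0ℚ
      by-cases (yes d) = ⊥-elim (¬d d)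
      by-cases (no _)  = refl

    degenerate-nonPos : ∀ u i j → ¬ Distinct3 u i j → pivotTerm u i j ≤ 0ℚ
    degenerate-nonPos u i j ¬d = by-cases (i ≟ j) (u ≟ i) (u ≟ j)
      where
      by-cases : Dec (i ≡ j) → Dec (u ≡ i) → Dec (u ≡ j) → pivotTerm u i j ≤ 0ℚ
      by-cases (yes refl) _          _          = ≤-reflexive (pivotTerm-diagonal u i)
      by-cases (no i≢j)   (yes refl) _          = pivotTerm-endpoint u j (i≢j ∘ sym)
      by-cases (no i≢j)   (no u≢i)   (yes refl) = ≤-trans (≤-reflexive (pivotTerm-sym u i u)) (pivotTerm-endpoint u i (u≢i ∘ sym))
      by-cases (no i≢j)   (no u≢i)   (no u≢j)   = ⊥-elim (¬d (u≢i , u≢j , i≢j))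

    pivotTerm≤nondegenerate : ∀ u i j → pivotTerm u i j ≤ nondegenerate u i j
    pivotTerm≤nondegenerate u i j = by-cases (distinct3? u i j)
      where
      by-cases : (d? : Dec (Distinct3 u i j)) → pivotTerm u i j ≤ (if ⌊ d? ⌋ then pivotTerm u i j else 0ℚ)
      by-cases (yes _) = ≤-refl
      by-cases (no ¬d) = degenerate-nonPos u i j ¬d

    triangle-pivotTerms : ∀ {u i j} → Distinct3 u i j →
      pivotTerm u i j + (pivotTerm i u j + pivotTerm j i u)
        ≡ triangleSum (elem u U) (elem i U) (elem j U) (pos G u i) (mem F u i) (pos G i j) (mem F i j) (pos G u j) (mem F u j)
    triangle-pivotTerms {u} {i} {j} (u≢i , u≢j , i≢j)
      rewrite ⌊≟⌋-≢ (u≢i ∘ sym) | ⌊≟⌋-≢ (u≢j ∘ sym) | ⌊≟⌋-≢ i≢j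
            | ⌊≟⌋-≢ u≢i | ⌊≟⌋-≢ (i≢j ∘ sym) | ⌊≟⌋-≢ u≢j
            | pos-sym G i u | mem-sym F i u | pos-sym G j i | mem-sym F j i | pos-sym G j u | mem-sym F j u = refl

    triangle-nonPos : ∀ u i j → nondegenerate u i j + (nondegenerate i u j + nondegenerate j i u) ≤ 0ℚ
    triangle-nonPos u i j = by-cases (distinct3? u i j)
      where
      by-cases : Dec (Distinct3 u i j) → nondegenerate u i j + (nondegenerate i u j + nondegenerate j i u) ≤ 0ℚ
      by-cases (yes d@(u≢i , u≢j , i≢j)) = begin
        nondegenerate u i j + (nondegenerate i u j + nondegenerate j i u)
          ≡⟨ cong₂ _+_ (nondegenerate-distinct d)
                       (cong₂ _+_ (nondegenerate-distinct (u≢i ∘ sym , i≢j , u≢j))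
                                  (nondegenerate-distinct (i≢j ∘ sym , u≢j ∘ sym , u≢i ∘ sym))) ⟩
        pivotTerm u i j + (pivotTerm i u j + pivotTerm j i u)
          ≡⟨ triangle-pivotTerms d ⟩
        triangleSum (elem u U) (elem i U) (elem j U) (pos G u i) (mem F u i) (pos G i j) (mem F i j) (pos G u j) (mem F u j)
          ≤⟨ triangleSum-nonPos (elem u U) (elem i U) (elem j U) (pos G u i) (mem F u i) (pos G i j) (mem F i j) (pos G u j) (mem F u j)
                                 (λ bad → cover u i j (u≢i , i≢j , u≢j , bad)) ⟩
        0ℚ ∎
        where open ≤-Reasoning
      by-cases (no ¬d) = ≤-reflexive (cong₂ _+_ (nondegenerate-degenerate ¬d)
        (cong₂ _+_ (nondegenerate-degenerate (λ (i≢u , i≢j , u≢j) → ¬d (i≢u ∘ sym , u≢j , i≢j)))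
                   (nondegenerate-degenerate (λ (j≢i , j≢u , i≢u) → ¬d (i≢u ∘ sym , j≢u ∘ sym , j≢i ∘ sym)))))

    charging : ∑[ u ∈ U ] ∑[ y ∈ outcomes u U ] weight y * roundExcess U (u ∷ joined y) ≤ 0ℚ
    charging = x+x≤0⇒x≤0 _ (begin
      expected + expected
        ≡⟨ cong₂ _+_ by-pivot by-pivot ⟩
      (∑[ u ∈ allFin n ] ⟦ elem u U ⟧ * pairSum (expectedExcess u)) + (∑[ u ∈ allFin n ] ⟦ elem u U ⟧ * pairSum (expectedExcess u))
        ≡⟨ ∑-distrib-+ (allFin n) _ _ ⟨
      ∑[ u ∈ allFin n ] ⟦ elem u U ⟧ * pairSum (expectedExcess u) + ⟦ elem u U ⟧ * pairSum (expectedExcess u)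
        ≡⟨ ∑-cong (allFin n) ordered-pairs ⟩
      ∑³ pivotTerm
        ≤⟨ ∑³-mono pivotTerm≤nondegenerate ⟩
      ∑³ nondegenerate
        ≤⟨ x+x+x≤0⇒x≤0 _ (≤-trans (≤-reflexive (sym (∑³-rotations nondegenerate))) (∑³-nonPos triangle-nonPos)) ⟩
      0ℚ ∎)
      where
      open ≤-Reasoning
      expected : ℚ
      expected = ∑[ u ∈ U ] ∑[ y ∈ outcomes u U ] weight y * roundExcess U (u ∷ joined y)
      by-pivot : expected ≡ ∑[ u ∈ allFin n ] ⟦ elem u U ⟧ * pairSum (expectedExcess u)
      by-pivot = trans (∑-cong U round-expectation) (∑-unique uniqueU (λ u → pairSum (expectedExcess u)))
      ordered-pairs : ∀ u → ⟦ elem u U ⟧ * pairSum (expectedExcess u) + ⟦ elem u U ⟧ * pairSum (expectedExcess u)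
                            ≡ ∑[ i ∈ allFin n ] ∑[ j ∈ allFin n ] pivotTerm u i j
      ordered-pairs u =
        trans (sym (*-distribˡ-+ ⟦ elem u U ⟧ _ _))
          (trans (cong (⟦ elem u U ⟧ *_) (pairSum-sym (expectedExcess u) (expectedExcess-sym u)))
            (trans (*-distribˡ-∑ (allFin n) ⟦ elem u U ⟧ _)
              (∑-cong (allFin n) (λ i → *-distribˡ-∑ (allFin n) ⟦ elem u U ⟧ _))))

  Within-∷ : ∀ {U P O C} → Partition U P O → Within O C → Within U (P ∷ C)
  Within-∷ {P = P} π within i j together with ∨≡true {elem i P ∧ elem j P} together
  ... | inj₁ both∈P = let (i∈P , j∈P) = ∧≡true both∈P in cong₂ _∧_ (⊆ˡ π i∈P) (⊆ˡ π j∈P)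
  ... | inj₂ sameC  = let (i∈O , j∈O) = ∧≡true (within i j sameC) in cong₂ _∧_ (⊆ʳ π i∈O) (⊆ʳ π j∈O)

  Proper : List (Fin n) → ℚ × Clustering n → Set
  Proper U z = 0ℚ ≤ proj₁ z × Within U (proj₂ z)

  expectedCost : ℕ → List (Fin n) → ℚ
  expectedCost fuel U = ∑[ z ∈ pivotRun G F fuel U ] proj₁ z * cost U (proj₂ z)

  extend : ℕ → Fin n → Outcome n → ℚ × Clustering n → ℚ × Clustering n
  extend k u y z = ((+ 1 / suc k) * weight y * proj₁ z , (u ∷ joined y) ∷ proj₂ z)

  afterRound : ℕ → ℕ → Fin n → Outcome n → Dist (Clustering n)
  afterRound fuel k u y = map (extend k u y) (pivotRun G F fuel (rest y))

  run-unfold : ∀ fuel x xs (H : ℚ × Clustering n → ℚ) →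
    ∑ (pivotRun G F (suc fuel) (x ∷ xs)) H
      ≡ ∑[ u ∈ x ∷ xs ] ∑[ y ∈ outcomes u (x ∷ xs) ] ∑[ z ∈ pivotRun G F fuel (rest y) ] H (extend (length xs) u y z)
  run-unfold fuel x xs H =
    trans (∑-concatMap (λ u → concatMap (afterRound fuel (length xs) u) (outcomes u (x ∷ xs))) (x ∷ xs) H) (∑-cong (x ∷ xs) (λ u →
      trans (∑-concatMap (afterRound fuel (length xs) u) (outcomes u (x ∷ xs)) H) (∑-cong (outcomes u (x ∷ xs)) (λ y →
        ∑-map (extend (length xs) u y) (pivotRun G F fuel (rest y)) H))))

  rest-fits : ∀ {fuel} {u : Fin n} {U} {y : Outcome n} →
              u ∈ U → length U ℕ.≤ suc fuel → Splits (removeAt u U) y → length (rest y) ℕ.≤ fuel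
  rest-fits u∈U U≤ s = ℕₚ.≤-pred (ℕₚ.≤-trans (ℕ.s≤s (rest-length s)) (ℕₚ.≤-trans (removeAt-length< u∈U) U≤))

  run-proper : ∀ fuel {U} → Unique U → length U ℕ.≤ fuel → All (Proper U) (pivotRun G F fuel U)
  run-proper fuel       {[]}     []  _  = (≤ᵇ⇒≤ _ , λ _ _ ()) ∷ []
  run-proper (suc fuel) {x ∷ xs} uU U≤ =
    concat⁺ (gmap⁺ {f = λ u → concatMap (afterRound fuel (length xs) u) (outcomes u (x ∷ xs))} (λ {u} u∈U →
      concat⁺ (gmap⁺ {f = afterRound fuel (length xs) u} (λ {y} s →
        gmap⁺ {f = extend (length xs) u y}
              (λ {z} (0≤r , within) → 0≤* (0≤* (0≤1/n (length xs)) (weight-nonNeg s)) 0≤r ,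
                                       Within-∷ {C = proj₂ z} (pivot-partition u∈U (partition s)) within)
              (run-proper fuel (rest-unique s) (rest-fits u∈U U≤ s)))
        (Round.choose-splits u (removeAt-unique u uU))))
      (All.tabulate (λ u∈U → u∈U)))

  run-mass : ∀ fuel {U} → Unique U → length U ℕ.≤ fuel → ∑ (pivotRun G F fuel U) proj₁ ≡ 1ℚ
  run-mass fuel       {[]}     []  _  = +-identityʳ 1ℚ
  run-mass (suc fuel) {x ∷ xs} uU U≤ = begin
    ∑ (pivotRun G F (suc fuel) (x ∷ xs)) proj₁
      ≡⟨ run-unfold fuel x xs proj₁ ⟩
    ∑[ u ∈ x ∷ xs ] ∑[ y ∈ outcomes u (x ∷ xs) ] ∑[ z ∈ pivotRun G F fuel (rest y) ] c * weight y * proj₁ z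
      ≡⟨ ∑-cong-All (All.tabulate (λ u∈U → u∈U)) (λ {u} u∈U → ∑-cong-All (Round.choose-splits u (removeAt-unique u uU)) (λ {y} s →
           trans (sym (*-distribˡ-∑ (pivotRun G F fuel (rest y)) (c * weight y) proj₁))
                 (trans (cong (c * weight y *_) (run-mass fuel (rest-unique s) (rest-fits u∈U U≤ s))) (*-identityʳ _)))) ⟩
    ∑[ u ∈ x ∷ xs ] ∑[ y ∈ outcomes u (x ∷ xs) ] c * weight y
      ≡⟨ ∑-cong (x ∷ xs) (λ u → trans (sym (*-distribˡ-∑ (outcomes u (x ∷ xs)) c weight))
                                      (trans (cong (c *_) (Round.choose-mass u (removeAt u (x ∷ xs)))) (*-identityʳ c))) ⟩
    ∑[ u ∈ x ∷ xs ] c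
      ≡⟨ ∑-const (x ∷ xs) c ⟩
    fromℕ (suc (length xs)) * c
      ≡⟨ trans (*-comm _ c) (1/n*n≡1 (length xs)) ⟩
    1ℚ ∎
    where
    open ≡-Reasoning
    c = + 1 / suc (length xs)

  cost-given-round : ∀ {fuel} {u : Fin n} {U} {y : Outcome n} → u ∈ U → Splits (removeAt u U) y →
    All (Proper (rest y)) (pivotRun G F fuel (rest y)) → ∑ (pivotRun G F fuel (rest y)) proj₁ ≡ 1ℚ →
    expectedCost fuel (rest y) ≤ 3/2 * coverIn (rest y) →
    ∑[ z ∈ pivotRun G F fuel (rest y) ] proj₁ z * cost U ((u ∷ joined y) ∷ proj₂ z)
      ≤ 3/2 * coverIn U + roundExcess U (u ∷ joined y)
  cost-given-round {fuel} {u} {U} {y} u∈U s sound mass bound = begin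
    ∑[ z ∈ R ] proj₁ z * cost U (P ∷ proj₂ z)
      ≡⟨ ∑-cong-All sound (λ {z} (_ , within) →
           trans (cong (proj₁ z *_) (cost-split {C = proj₂ z} π within)) (*-distribˡ-+ (proj₁ z) _ _)) ⟩
    ∑[ z ∈ R ] proj₁ z * cost O (proj₂ z) + proj₁ z * roundCost U P
      ≡⟨ ∑-distrib-+ R _ _ ⟩
    expectedCost fuel O + (∑[ z ∈ R ] proj₁ z * roundCost U P)
      ≡⟨ cong (_+_ (expectedCost fuel O)) (trans (sym (*-distribʳ-∑ R (roundCost U P) proj₁))
                                                 (trans (cong (_* roundCost U P) mass) (*-identityˡ _))) ⟩
    expectedCost fuel O + roundCost U P
      ≤⟨ +-monoˡ-≤ (roundCost U P) bound ⟩
    3/2 * coverIn O + roundCost U P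
      ≡⟨ regroup (coverIn O) (roundCover U P) (roundCost U P) ⟩
    3/2 * (coverIn O + roundCover U P) + (roundCost U P - 3/2 * roundCover U P)
      ≡⟨ cong₂ (λ a b → 3/2 * a + b) (sym (coverIn-split π)) (roundCost-roundCover U P) ⟩
    3/2 * coverIn U + roundExcess U P ∎
    where
    open ≤-Reasoning
    P = u ∷ joined y
    O = rest y
    R = pivotRun G F fuel O
    π = pivot-partition u∈U (partition s)
    regroup : ∀ a b c → 3/2 * a + c ≡ 3/2 * (a + b) + (c - 3/2 * b)
    regroup a b c = solve 4 (λ h a b c → h :* a :+ c := h :* (a :+ b) :+ (c :- h :* b)) refl 3/2 a b c

  average-rounds : ∀ x xs K (X : Fin n → Outcome n → ℚ) →
    ∑[ u ∈ x ∷ xs ] ∑[ y ∈ outcomes u (x ∷ xs) ] (+ 1 / suc (length xs)) * weight y * (K + X u y)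
      ≡ K + (+ 1 / suc (length xs)) * (∑[ u ∈ x ∷ xs ] ∑[ y ∈ outcomes u (x ∷ xs) ] weight y * X u y)
  average-rounds x xs K X = begin
    ∑[ u ∈ U ] ∑[ y ∈ outcomes u U ] c * weight y * (K + X u y)
      ≡⟨ ∑-cong U (λ u → trans (∑-cong (outcomes u U) (λ y → expand (weight y) (X u y)))
                                  (∑-distrib-+ (outcomes u U) (λ y → c * K * weight y) (λ y → c * (weight y * X u y)))) ⟩
    ∑[ u ∈ U ] (∑[ y ∈ outcomes u U ] c * K * weight y) + (∑[ y ∈ outcomes u U ] c * (weight y * X u y))
      ≡⟨ ∑-cong U (λ u → cong₂ _+_ (trans (sym (*-distribˡ-∑ (outcomes u U) (c * K) weight))
                                           (trans (cong (c * K *_) (Round.choose-mass u (removeAt u U))) (*-identityʳ (c * K))))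
                                    (sym (*-distribˡ-∑ (outcomes u U) c _))) ⟩
    ∑[ u ∈ U ] c * K + c * (∑[ y ∈ outcomes u U ] weight y * X u y)
      ≡⟨ ∑-distrib-+ U (λ _ → c * K) (λ u → c * (∑[ y ∈ outcomes u U ] weight y * X u y)) ⟩
    (∑[ u ∈ U ] c * K) + (∑[ u ∈ U ] c * (∑[ y ∈ outcomes u U ] weight y * X u y))
      ≡⟨ cong₂ _+_ uniform (sym (*-distribˡ-∑ U c _)) ⟩
    K + c * (∑[ u ∈ U ] ∑[ y ∈ outcomes u U ] weight y * X u y) ∎
    where
    open ≡-Reasoning
    U = x ∷ xs
    c = + 1 / suc (length xs)
    expand : ∀ w e → c * w * (K + e) ≡ c * K * w + c * (w * e)
    expand w e = solve 4 (λ c w K e → c :* w :* (K :+ e) := c :* K :* w :+ c :* (w :* e)) refl c w K e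
    uniform : ∑[ u ∈ U ] c * K ≡ K
    uniform = begin
      ∑[ u ∈ U ] c * K                   ≡⟨ ∑-const U (c * K) ⟩
      fromℕ (length U) * (c * K)         ≡⟨ *-assoc (fromℕ (length U)) c K ⟨
      fromℕ (length U) * c * K           ≡⟨ cong (_* K) (trans (*-comm (fromℕ (length U)) c) (1/n*n≡1 (length xs))) ⟩
      1ℚ * K                             ≡⟨ *-identityˡ K ⟩
      K                                  ∎

  expectedMistakes≡expectedCost : expectedMistakes G F ≡ expectedCost n (allFin n)
  expectedMistakes≡expectedCost = trans (expectation≡∑ (mistakes G) (pivotDist G F))
    (∑-cong (pivotDist G F) (λ z → cong (proj₁ z *_) (mistakes≡cost (proj₂ z))))

  module _ (cover : IsBadTriangleCover G F) where

    expectedCost-bound : ∀ fuel {U} → Unique U → length U ℕ.≤ fuel → expectedCost fuel U ≤ 3/2 * coverIn U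
    expectedCost-bound fuel       {[]}     []  _  = ≤-reflexive (trans (+-identityʳ _) (trans (*-identityˡ _)
      (trans (pairSum-0 {n}) (sym (trans (cong (3/2 *_) (pairSum-0 {n})) (*-zeroʳ 3/2))))))
    expectedCost-bound (suc fuel) {x ∷ xs} uU U≤ = begin
      expectedCost (suc fuel) U
        ≡⟨ run-unfold fuel x xs (λ z → proj₁ z * cost U (proj₂ z)) ⟩
      ∑[ u ∈ U ] ∑[ y ∈ outcomes u U ] ∑[ z ∈ pivotRun G F fuel (rest y) ] c * weight y * proj₁ z * cost U ((u ∷ joined y) ∷ proj₂ z)
        ≡⟨ ∑-cong U (λ u → ∑-cong (outcomes u U) (λ y →
             trans (∑-cong (pivotRun G F fuel (rest y)) (λ z → *-assoc (c * weight y) (proj₁ z) _))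
                   (sym (*-distribˡ-∑ (pivotRun G F fuel (rest y)) (c * weight y) _)))) ⟩
      ∑[ u ∈ U ] ∑[ y ∈ outcomes u U ] c * weight y * (∑[ z ∈ pivotRun G F fuel (rest y) ] proj₁ z * cost U ((u ∷ joined y) ∷ proj₂ z))
        ≤⟨ ∑-mono-All (All.tabulate (λ u∈U → u∈U)) (λ {u} u∈U →
             ∑-mono-All (Round.choose-splits u (removeAt-unique u uU)) (λ {y} s →
               *-monoˡ-≤-0≤ (0≤* (0≤1/n (length xs)) (weight-nonNeg s)) (by-induction u∈U s))) ⟩
      ∑[ u ∈ U ] ∑[ y ∈ outcomes u U ] c * weight y * (3/2 * coverIn U + roundExcess U (u ∷ joined y))
        ≡⟨ average-rounds x xs (3/2 * coverIn U) (λ u y → roundExcess U (u ∷ joined y)) ⟩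
      3/2 * coverIn U + c * (∑[ u ∈ U ] ∑[ y ∈ outcomes u U ] weight y * roundExcess U (u ∷ joined y))
        ≤⟨ +-monoʳ-≤ (3/2 * coverIn U) (≤-trans (*-monoˡ-≤-0≤ (0≤1/n (length xs)) (Charging.charging cover uU))
                                                (≤-reflexive (*-zeroʳ c))) ⟩
      3/2 * coverIn U + 0ℚ
        ≡⟨ +-identityʳ _ ⟩
      3/2 * coverIn U ∎
      where
      open ≤-Reasoning
      U = x ∷ xs
      c = + 1 / suc (length xs)
      by-induction : ∀ {u y} → u ∈ U → Splits (removeAt u U) y →
        ∑[ z ∈ pivotRun G F fuel (rest y) ] proj₁ z * cost U ((u ∷ joined y) ∷ proj₂ z)
          ≤ 3/2 * coverIn U + roundExcess U (u ∷ joined y)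
      by-induction u∈U s = cost-given-round u∈U s (run-proper fuel O-unique O-fits) (run-mass fuel O-unique O-fits)
                                                 (expectedCost-bound fuel O-unique O-fits)
        where
        O-unique = rest-unique s
        O-fits   = rest-fits u∈U U≤ s

theorem8 : ∀ {n : ℕ} (G : SignedGraph n) (F : PairSet n) →
    IsBadTriangleCover G F →
    expectedMistakes G F ≤ (+ (3 Data.Nat.* card F)) / 2
theorem8 {n} G F cover = begin
  expectedMistakes G F       ≡⟨ expectedMistakes≡expectedCost ⟩
  expectedCost n (allFin n)  ≤⟨ expectedCost-bound cover n (allFin⁺ n) (ℕₚ.≤-reflexive (length-tabulate id)) ⟩
  3/2 * coverIn (allFin n)   ≡⟨ cong (3/2 *_) card≡coverIn ⟨
  3/2 * fromℕ (card F)       ≡⟨ 3/2*n≡3n/2 (card F) ⟩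
  + (3 ℕ.* card F) / 2       ∎
  where
  open Analysis G F
  open ≤-Reasoning
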